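{- Let $k$ and $j$ be fixed positive integers with $k \geq 4$ and $k-2 \geq j \geq 2$. Let $\Pi$ be a projective plane of order $n$ with $n \geq k$. Then $$|Q_{k,j}| \leq j^{k-j}\,k_{(j)}\binom{N}{j}(n-1)^{k-j} = O(n^{j+k}) \quad (n \to \infty),$$ and $$|Q_{k,1}| = N\,(n+1)_{(k)}.$$
   Context: $N = n^2+n+1$ is the number of points (and of lines) of $\Pi$; for a positive integer $x$, $x_{(m)} = x(x-1)\cdots(x-m+1)$. For distinct points $A, B$, $AB$ denotes the line through them. A quasi $k$-gon is a sequence $QG_k = (P_1, \dots, P_k)$ of $k$ distinct points of $\Pi$, with indices read modulo $k$; $\mathcal{L}_{QG_k}$ denotes the set of distinct lines among $P_1P_2, P_2P_3, \dots, P_kP_1$. $Q_{k,j}$ is the set of quasi $k$-gons $QG_k$ in $\Pi$ with $|\mathcal{L}_{QG_k}| = j$. -}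

module Defs where

open import Data.Nat using (ℕ; zero; suc; _+_; _*_; _≡ᵇ_)
open import Data.Bool using (Bool; true; false; T; not; _∧_; if_then_else_)
open import Data.Fin using (Fin; _≟_)
open import Data.List using (List; []; _∷_; [_]; map; concatMap; allFin; length; filter; zip; _++_)
open import Data.Bool.ListAction using (any)
open import Data.Vec using (Vec; toList) renaming ([] to []ᵥ; _∷_ to _∷ᵥ_)
open import Data.Product using (_×_; _,_; Σ; ∃)
open import Relation.Nullary using (¬_; does)
open import Relation.Binary.PropositionalEquality using (_≡_; _≢_)

N : ℕ → ℕ
N n = n * n + n + 1

countFin : ∀ {m} → (Fin m → Bool) → ℕ
countFin {m} p = length (filter (λ x → Data.Bool._≟_ (p x) true) (allFin m))

-- A projective plane of order n, with point set Fin N and line set Fin N.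
-- P I l : point P lies on line l.  join A B is the line AB.
record ProjectivePlane (n : ℕ) : Set where
  field
    _I_        : Fin (N n) → Fin (N n) → Bool
    join       : Fin (N n) → Fin (N n) → Fin (N n)
    join-inc   : ∀ A B → A ≢ B → T (A I join A B) × T (B I join A B)
    join-uniq  : ∀ A B l → A ≢ B → T (A I l) → T (B I l) → l ≡ join A B
    -- two distinct lines meet in a point (necessarily unique by join-uniq)
    meet       : ∀ l m → l ≢ m → Σ (Fin (N n)) λ P → T (P I l) × T (P I m)
    nondeg     : Σ (Fin (N n)) λ a → Σ (Fin (N n)) λ b → Σ (Fin (N n)) λ c → Σ (Fin (N n)) λ d →
                   a ≢ b × a ≢ c × a ≢ d × b ≢ c × b ≢ d × c ≢ d ×
                   (¬ ∃ λ l → T (a I l) × T (b I l) × T (c I l)) ×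
                   (¬ ∃ λ l → T (a I l) × T (b I l) × T (d I l)) ×
                   (¬ ∃ λ l → T (a I l) × T (c I l) × T (d I l)) ×
                   (¬ ∃ λ l → T (b I l) × T (c I l) × T (d I l))
    line-size  : ∀ l → countFin (λ P → P I l) ≡ suc n

allVecs : (m k : ℕ) → List (Vec (Fin m) k)
allVecs m zero    = []ᵥ ∷ []
allVecs m (suc k) = concatMap (λ x → map (x ∷ᵥ_) (allVecs m k)) (allFin m)

eqFin : ∀ {m} → Fin m → Fin m → Bool
eqFin x y = does (x ≟ y)

allDistinct : ∀ {m} → List (Fin m) → Bool
allDistinct []       = true
allDistinct (x ∷ xs) = not (any (eqFin x) xs) ∧ allDistinct xs

cycPairs : ∀ {A : Set} → List A → List (A × A)
cycPairs []       = []
cycPairs (x ∷ xs) = zip (x ∷ xs) (xs ++ [ x ])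

module _ {n : ℕ} (Π : ProjectivePlane n) where
  open ProjectivePlane Π

  numLines : ∀ {k} → Vec (Fin (N n)) k → ℕ
  numLines P = countFin (λ l → any (λ { (a , b) → eqFin l (join a b) }) (cycPairs (toList P)))

  isQuasiGon : ∀ {k} → Vec (Fin (N n)) k → Bool
  isQuasiGon P = allDistinct (toList P)

  Qcount : (k j : ℕ) → ℕ
  Qcount k j = length (filter (λ P → Data.Bool._≟_ (isQuasiGon P ∧ (numLines P ≡ᵇ j)) true) (allVecs (N n) k))

-- A quasi-gon with a single line is a tuple of distinct points on a line, and (having two
-- distinct points) it lies on exactly one line; summing over the N lines of n + 1 points each
-- gives |Q_{k,1}| = N (n+1)_(k).
--
-- For j ≥ 2 we count quasi-gons through their side sequences L_i = P_iP_{i+1}. At most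
-- C(N,j) k_(j) j^(k-j) sequences of k lines take exactly j distinct values. Given the side
-- sequence, a vertex whose two sides differ is their intersection point. At a free vertex,
-- where both sides equal a line l, the vertex lies on l and avoids the two distinct points
-- where the polygon enters and leaves l; as these are determined by the side sequence, this
-- leaves n - 1 choices. Each of the j lines is entered at a vertex whose sides differ, so at
-- most k - j vertices are free and each side sequence carries at most (n-1)^(k-j) quasi-gons.

module Submission where

open import Defs
open import Data.Nat using (ℕ; zero; suc; pred; >-nonZero; _+_; _*_; _∸_; _^_; _≤_; _<_; z≤n; s≤s; s≤s⁻¹; _≡ᵇ_; _≤ᵇ_; _≤?_; _<?_)
open import Data.Nat.Properties
open import Data.Nat.Combinatorics using (_P_; _C_; nCk+nC[k+1]≡[n+1]C[k+1]; nC1≡n; k>n⇒nPk≡0)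
open import Data.Nat.Combinatorics.Base using (_P′_)
open import Data.Nat.Combinatorics.Specification using (P′-rec)
open import Data.Nat.Solver using (module +-*-Solver)
open import Data.Bool using (Bool; true; false; T; not; _∧_; _∨_; if_then_else_)
import Data.Bool as Bool
open import Data.Bool.Properties using (∧-zeroʳ; ∧-identityʳ; ∨-identityʳ; ∨-assoc; ∧-commutativeMonoid)
import Algebra.Solver.CommutativeMonoid ∧-commutativeMonoid as ∧-Solver
open import Data.Bool.ListAction using (any)
open import Data.Fin using (Fin; zero; suc)
import Data.Fin as Fin
import Data.Fin.Properties as Fin
open import Data.List using (List; []; _∷_; [_]; map; concatMap; allFin; length; filter; zip; _++_)
import Data.List.Properties as List
open import Data.List.Relation.Unary.Any using (here; there)
open import Data.List.Membership.Propositional using (_∈_; _∉_)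
open import Data.List.Membership.Propositional.Properties using (∈-++⁻; ∈-filter⁺; ∈-map⁺; ∈-map⁻)
open import Data.Vec using (Vec; toList) renaming ([] to []ᵥ; _∷_ to _∷ᵥ_)
import Data.Vec.Properties as Vec
open import Data.Maybe using (Maybe; just; nothing)
open import Data.Product using (_×_; _,_; ∃; proj₁; proj₂)
open import Data.Sum using (inj₁; inj₂)
open import Data.Empty using (⊥-elim)
open import Relation.Nullary using (yes; no)
open import Relation.Nullary.Decidable using (dec-true; dec-false; _×-dec_; ¬?)
open import Relation.Binary.PropositionalEquality using (_≡_; _≢_; refl; sym; trans; cong; cong₂; subst; module ≡-Reasoning)
open import Function using (_∘_; id)

private variable
  A B : Set

-- Sums over lists and counting

∧-true⁻ : ∀ {a b} → a ∧ b ≡ true → a ≡ true × b ≡ true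
∧-true⁻ {true} {true} _ = refl , refl

∧-true⁺ : ∀ {a b} → a ≡ true → b ≡ true → a ∧ b ≡ true
∧-true⁺ refl refl = refl

not-true⇒false : ∀ {b} → not b ≡ true → b ≡ false
not-true⇒false {false} _ = refl

T⇒≡true : ∀ {b} → T b → b ≡ true
T⇒≡true {true} _ = refl

≡true⇒T : ∀ {b} → b ≡ true → T b
≡true⇒T refl = _

≡-by-true : ∀ {a b} → (a ≡ true → b ≡ true) → (b ≡ true → a ≡ true) → a ≡ b
≡-by-true {false} {false} _   _   = refl
≡-by-true {false} {true}  _   b⇒a = b⇒a refl
≡-by-true {true}  {false} a⇒b _   = sym (a⇒b refl)
≡-by-true {true}  {true}  _   _   = refl

𝟙 : Bool → ℕ
𝟙 true  = 1
𝟙 false = 0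

𝟙-∧ : ∀ a b → 𝟙 (a ∧ b) ≡ 𝟙 a * 𝟙 b
𝟙-∧ true  b = sym (+-identityʳ (𝟙 b))
𝟙-∧ false b = refl

𝟙-≡ᵇ-≢ : ∀ {a b} → a ≢ b → 𝟙 (a ≡ᵇ b) ≡ 0
𝟙-≡ᵇ-≢ {a} {b} a≢b with a ≡ᵇ b in eq
... | true  = ⊥-elim (a≢b (≡ᵇ⇒≡ a b (≡true⇒T eq)))
... | false = refl

∑ : (A → ℕ) → List A → ℕ
∑ f []       = 0
∑ f (x ∷ xs) = f x + ∑ f xs

syntax ∑ (λ x → e) xs = ∑[ x ∈ xs ] e

count : (A → Bool) → List A → ℕ
count p xs = ∑[ x ∈ xs ] 𝟙 (p x)

length-filter≡count : ∀ (p : A → Bool) xs → length (filter (λ x → p x Bool.≟ true) xs) ≡ count p xs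
length-filter≡count p [] = refl
length-filter≡count p (x ∷ xs) with p x
... | true  = cong suc (length-filter≡count p xs)
... | false = length-filter≡count p xs

∑-cong : ∀ {f g : A → ℕ} → (∀ x → f x ≡ g x) → ∀ xs → ∑ f xs ≡ ∑ g xs
∑-cong f≡g []       = refl
∑-cong f≡g (x ∷ xs) = cong₂ _+_ (f≡g x) (∑-cong f≡g xs)

∑-mono-≤ : ∀ {f g : A → ℕ} → (∀ x → f x ≤ g x) → ∀ xs → ∑ f xs ≤ ∑ g xs
∑-mono-≤ f≤g []       = z≤n
∑-mono-≤ f≤g (x ∷ xs) = +-mono-≤ (f≤g x) (∑-mono-≤ f≤g xs)

∑-++ : ∀ (f : A → ℕ) xs ys → ∑ f (xs ++ ys) ≡ ∑ f xs + ∑ f ys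
∑-++ f []       ys = refl
∑-++ f (x ∷ xs) ys = trans (cong (f x +_) (∑-++ f xs ys)) (sym (+-assoc (f x) _ _))

∑-map : (f : B → ℕ) (g : A → B) (xs : List A) → ∑ f (map g xs) ≡ ∑ (f ∘ g) xs
∑-map f g []       = refl
∑-map f g (x ∷ xs) = cong (f (g x) +_) (∑-map f g xs)

∑-concatMap : (f : B → ℕ) (h : A → List B) (xs : List A) →
              ∑ f (concatMap h xs) ≡ ∑[ x ∈ xs ] ∑ f (h x)
∑-concatMap f h []       = refl
∑-concatMap f h (x ∷ xs) = trans (∑-++ f (h x) (concatMap h xs)) (cong (∑ f (h x) +_) (∑-concatMap f h xs))

∑-zero : ∀ (xs : List A) → ∑ (λ _ → 0) xs ≡ 0
∑-zero []       = refl
∑-zero (x ∷ xs) = ∑-zero xs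

∑-const : ∀ c (xs : List A) → ∑ (λ _ → c) xs ≡ length xs * c
∑-const c []       = refl
∑-const c (x ∷ xs) = cong (c +_) (∑-const c xs)

∑-distrib-+ : ∀ (f g : A → ℕ) xs → ∑[ x ∈ xs ] (f x + g x) ≡ ∑ f xs + ∑ g xs
∑-distrib-+ f g []       = refl
∑-distrib-+ f g (x ∷ xs) = begin
  f x + g x + ∑[ y ∈ xs ] (f y + g y) ≡⟨ cong (f x + g x +_) (∑-distrib-+ f g xs) ⟩
  f x + g x + (∑ f xs + ∑ g xs)       ≡⟨ interchange (f x) (g x) (∑ f xs) (∑ g xs) ⟩
  f x + ∑ f xs + (g x + ∑ g xs)       ∎
  where
  open ≡-Reasoning
  open +-*-Solver
  interchange : ∀ a b c d → a + b + (c + d) ≡ a + c + (b + d)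
  interchange = solve 4 (λ a b c d → a :+ b :+ (c :+ d) := a :+ c :+ (b :+ d)) refl

∑-*ʳ : ∀ (f : A → ℕ) c xs → ∑[ x ∈ xs ] (f x * c) ≡ ∑ f xs * c
∑-*ʳ f c []       = refl
∑-*ʳ f c (x ∷ xs) = trans (cong (f x * c +_) (∑-*ʳ f c xs)) (sym (*-distribʳ-+ c (f x) (∑ f xs)))

∑-*ˡ : ∀ (f : A → ℕ) c xs → ∑[ x ∈ xs ] (c * f x) ≡ c * ∑ f xs
∑-*ˡ f c []       = sym (*-zeroʳ c)
∑-*ˡ f c (x ∷ xs) = trans (cong (c * f x +_) (∑-*ˡ f c xs)) (sym (*-distribˡ-+ c (f x) (∑ f xs)))

∑-comm : (f : A → B → ℕ) (xs : List A) (ys : List B) →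
         ∑[ x ∈ xs ] ∑[ y ∈ ys ] f x y ≡ ∑[ y ∈ ys ] ∑[ x ∈ xs ] f x y
∑-comm f []       ys = sym (∑-zero ys)
∑-comm f (x ∷ xs) ys = trans (cong (∑ (f x) ys +_) (∑-comm f xs ys)) (sym (∑-distrib-+ (f x) _ ys))

∑-𝟙*-const : ∀ (p : A → Bool) (f : A → ℕ) c → (∀ x → p x ≡ true → f x ≡ c) →
             ∀ xs → ∑[ x ∈ xs ] (𝟙 (p x) * f x) ≡ count p xs * c
∑-𝟙*-const p f c f≡c xs = trans (∑-cong 𝟙*f≡𝟙*c xs) (∑-*ʳ (λ x → 𝟙 (p x)) c xs)
  where
  𝟙*f≡𝟙*c : ∀ x → 𝟙 (p x) * f x ≡ 𝟙 (p x) * c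
  𝟙*f≡𝟙*c x with p x in px
  ... | true  = cong (_+ 0) (f≡c x px)
  ... | false = refl

∑-split-≤ : ∀ (f : A → ℕ) (p : A → Bool) b₁ b₂ →
            (∀ x → p x ≡ true → f x ≤ b₁) → (∀ x → p x ≡ false → f x ≤ b₂) →
            ∀ xs → ∑ f xs ≤ count p xs * b₁ + count (not ∘ p) xs * b₂
∑-split-≤ f p b₁ b₂ h₁ h₂ []       = z≤n
∑-split-≤ f p b₁ b₂ h₁ h₂ (x ∷ xs) with p x in px
... | true  = subst (f x + ∑ f xs ≤_) (sym (+-assoc b₁ _ _)) (+-mono-≤ (h₁ x px) (∑-split-≤ f p b₁ b₂ h₁ h₂ xs))
... | false = subst (f x + ∑ f xs ≤_) (+-assoc-comm b₂ (count p xs * b₁) _)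
                    (+-mono-≤ (h₂ x px) (∑-split-≤ f p b₁ b₂ h₁ h₂ xs))
  where
  +-assoc-comm : ∀ a b c → a + (b + c) ≡ b + (a + c)
  +-assoc-comm a b c = trans (sym (+-assoc a b c)) (trans (cong (_+ c) (+-comm a b)) (+-assoc b a c))

count-mono : ∀ {p q : A → Bool} → (∀ x → p x ≡ true → q x ≡ true) → ∀ xs → count p xs ≤ count q xs
count-mono {p = p} {q} p⇒q = ∑-mono-≤ 𝟙-mono
  where
  𝟙-mono : ∀ x → 𝟙 (p x) ≤ 𝟙 (q x)
  𝟙-mono x with p x in px
  ... | false = z≤n
  ... | true  rewrite p⇒q x px = ≤-refl

count+count-not : ∀ (p : A → Bool) xs → count p xs + count (not ∘ p) xs ≡ length xs
count+count-not p []       = refl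
count+count-not p (x ∷ xs) with p x
... | true  = cong suc (count+count-not p xs)
... | false = trans (+-suc _ _) (cong suc (count+count-not p xs))

∑-allFin-suc : ∀ m (f : Fin (suc m) → ℕ) → ∑ f (allFin (suc m)) ≡ f zero + ∑ (f ∘ suc) (allFin m)
∑-allFin-suc m f = cong (f zero +_) (trans (cong (∑ f) (sym (List.map-tabulate id suc))) (∑-map f suc (allFin m)))

module _ {m : ℕ} where

  eqFin-refl : ∀ (x : Fin m) → eqFin x x ≡ true
  eqFin-refl x = dec-true (x Fin.≟ x) refl

  eqFin-≢ : ∀ {x y : Fin m} → x ≢ y → eqFin x y ≡ false
  eqFin-≢ {x} {y} = dec-false (x Fin.≟ y)

  eqFin⇒≡ : ∀ {x y : Fin m} → eqFin x y ≡ true → x ≡ y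
  eqFin⇒≡ {x} {y} _  with x Fin.≟ y
  eqFin⇒≡ _  | yes x≡y = x≡y
  eqFin⇒≡ () | no _

  eqFin-false⇒≢ : ∀ {x y : Fin m} → eqFin x y ≡ false → x ≢ y
  eqFin-false⇒≢ {x} eq refl with () ← trans (sym (eqFin-refl x)) eq

  eqFin-sym : ∀ (x y : Fin m) → eqFin x y ≡ eqFin y x
  eqFin-sym x y with x Fin.≟ y
  ... | yes refl = sym (eqFin-refl x)
  ... | no x≢y   = sym (eqFin-≢ (x≢y ∘ sym))

module _ {m : ℕ} where

  countFin≡count : ∀ (p : Fin m → Bool) → countFin p ≡ count p (allFin m)
  countFin≡count p = length-filter≡count p (allFin m)

  countFin-cong : ∀ {p q : Fin m → Bool} → (∀ x → p x ≡ q x) → countFin p ≡ countFin q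
  countFin-cong {p} {q} p≡q = begin
    countFin p                    ≡⟨ countFin≡count p ⟩
    count p (allFin m)            ≡⟨ ∑-cong (cong 𝟙 ∘ p≡q) (allFin m) ⟩
    count q (allFin m)            ≡⟨ countFin≡count q ⟨
    countFin q                    ∎
    where open ≡-Reasoning

  countFin-mono : ∀ {p q : Fin m → Bool} → (∀ x → p x ≡ true → q x ≡ true) → countFin p ≤ countFin q
  countFin-mono {p} {q} p⇒q = begin
    countFin p                    ≡⟨ countFin≡count p ⟩
    count p (allFin m)            ≤⟨ count-mono p⇒q (allFin m) ⟩
    count q (allFin m)            ≡⟨ countFin≡count q ⟨
    countFin q                    ∎
    where open ≤-Reasoning

  countFin-∨ : ∀ (p q : Fin m → Bool) → countFin (λ x → p x ∨ q x) ≤ countFin p + countFin q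
  countFin-∨ p q = begin
    countFin (λ x → p x ∨ q x)                ≡⟨ countFin≡count _ ⟩
    count (λ x → p x ∨ q x) (allFin m)        ≤⟨ ∑-mono-≤ (λ x → 𝟙-∨ (p x) (q x)) (allFin m) ⟩
    ∑[ x ∈ allFin m ] (𝟙 (p x) + 𝟙 (q x))    ≡⟨ ∑-distrib-+ _ _ (allFin m) ⟩
    count p (allFin m) + count q (allFin m)   ≡⟨ cong₂ _+_ (countFin≡count p) (countFin≡count q) ⟨
    countFin p + countFin q                   ∎
    where
    open ≤-Reasoning
    𝟙-∨ : ∀ a b → 𝟙 (a ∨ b) ≤ 𝟙 a + 𝟙 b
    𝟙-∨ true  b = s≤s z≤n
    𝟙-∨ false b = ≤-refl

  countFin-split : ∀ (p q : Fin m → Bool) → countFin p ≡ countFin (λ x → p x ∧ q x) + countFin (λ x → p x ∧ not (q x))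
  countFin-split p q = begin
    countFin p                                                         ≡⟨ countFin≡count p ⟩
    count p (allFin m)                                                 ≡⟨ ∑-cong (λ x → 𝟙-split (p x) (q x)) (allFin m) ⟩
    ∑[ x ∈ allFin m ] (𝟙 (p x ∧ q x) + 𝟙 (p x ∧ not (q x)))           ≡⟨ ∑-distrib-+ _ _ (allFin m) ⟩
    count (λ x → p x ∧ q x) (allFin m) + count (λ x → p x ∧ not (q x)) (allFin m)
                                                                       ≡⟨ cong₂ _+_ (countFin≡count _) (countFin≡count _) ⟨
    countFin (λ x → p x ∧ q x) + countFin (λ x → p x ∧ not (q x))     ∎
    where
    open ≡-Reasoning
    𝟙-split : ∀ a b → 𝟙 a ≡ 𝟙 (a ∧ b) + 𝟙 (a ∧ not b)
    𝟙-split true  true  = refl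
    𝟙-split true  false = refl
    𝟙-split false b     = refl

  countFin-true : countFin {m} (λ _ → true) ≡ m
  countFin-true = begin
    countFin {m} (λ _ → true) ≡⟨ countFin≡count _ ⟩
    ∑ (λ _ → 1) (allFin m)    ≡⟨ ∑-const 1 (allFin m) ⟩
    length (allFin m) * 1     ≡⟨ *-identityʳ _ ⟩
    length (allFin m)         ≡⟨ List.length-tabulate id ⟩
    m                         ∎
    where open ≡-Reasoning

  countFin-none : ∀ (p : Fin m → Bool) → (∀ x → p x ≡ false) → countFin p ≡ 0
  countFin-none p p≡false = trans (countFin≡count p) (trans (∑-cong (cong 𝟙 ∘ p≡false) (allFin m)) (∑-zero (allFin m)))

  countFin-not : ∀ (p : Fin m → Bool) → countFin (not ∘ p) ≡ m ∸ countFin p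
  countFin-not p = begin
    countFin (not ∘ p)                        ≡⟨ m+n∸m≡n (countFin p) _ ⟨
    countFin p + countFin (not ∘ p) ∸ countFin p ≡⟨ cong (_∸ countFin p) (countFin-split (λ _ → true) p) ⟨
    countFin {m} (λ _ → true) ∸ countFin p    ≡⟨ cong (_∸ countFin p) countFin-true ⟩
    m ∸ countFin p                            ∎
    where open ≡-Reasoning

countFin-eqFin : ∀ {m} (x : Fin m) → countFin (eqFin x) ≡ 1
countFin-eqFin x = trans (countFin≡count (eqFin x)) (count-eqFin x)
  where
  count-eqFin : ∀ {m} (x : Fin m) → count (eqFin x) (allFin m) ≡ 1
  count-eqFin {suc m} zero    = trans (∑-allFin-suc m (𝟙 ∘ eqFin zero)) (cong suc (∑-zero (allFin m)))
  count-eqFin {suc m} (suc x) = trans (∑-allFin-suc m (𝟙 ∘ eqFin (suc x))) (count-eqFin x)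

module _ {m : ℕ} where

  countFin-≤1 : ∀ (p : Fin m → Bool) x → (∀ y → p y ≡ true → y ≡ x) → countFin p ≤ 1
  countFin-≤1 p x only-x = subst (countFin p ≤_) (countFin-eqFin x)
    (countFin-mono (λ y py → subst (λ z → eqFin x z ≡ true) (sym (only-x y py)) (eqFin-refl x)))

  countFin-remove : ∀ (p : Fin m → Bool) y → p y ≡ true → countFin p ≡ suc (countFin (λ x → p x ∧ not (eqFin y x)))
  countFin-remove p y py = trans (countFin-split p (eqFin y))
    (cong (_+ countFin (λ x → p x ∧ not (eqFin y x))) (trans (countFin-cong p∧y≡y) (countFin-eqFin y)))
    where
    p∧y≡y : ∀ x → p x ∧ eqFin y x ≡ eqFin y x
    p∧y≡y x with y Fin.≟ x
    ... | yes refl = cong (_∧ true) py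
    ... | no _     = ∧-zeroʳ (p x)

  countFin≡1 : ∀ (p : Fin m → Bool) x → p x ≡ true → (∀ y → p y ≡ true → y ≡ x) → countFin p ≡ 1
  countFin≡1 p x px only-x = trans p≡suc (cong suc (n≤0⇒n≡0 (s≤s⁻¹ (subst (_≤ 1) p≡suc (countFin-≤1 p x only-x)))))
    where p≡suc = countFin-remove p x px

  countFin-≥2 : ∀ (p : Fin m → Bool) a b → p a ≡ true → p b ≡ true → a ≢ b → 2 ≤ countFin p
  countFin-≥2 p a b pa pb a≢b = subst (2 ≤_) (sym (countFin-remove p a pa))
    (s≤s (subst (1 ≤_) (sym (countFin-remove _ b (∧-true⁺ pb (cong not (eqFin-≢ a≢b))))) (s≤s z≤n)))

  countFin-≥2⇒≢ : ∀ (p : Fin m → Bool) x → 2 ≤ countFin p → ∃ λ y → p y ≡ true × y ≢ x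
  countFin-≥2⇒≢ p x 2≤p with Fin.any? (λ y → p y Bool.≟ true ×-dec ¬? (y Fin.≟ x))
  ... | yes witness = witness
  ... | no ¬witness = ⊥-elim (<⇒≱ 2≤p (countFin-≤1 p x only-x))
    where
    only-x : ∀ y → p y ≡ true → y ≡ x
    only-x y py with y Fin.≟ x
    ... | yes y≡x = y≡x
    ... | no y≢x  = ⊥-elim (¬witness (y , py , y≢x))

  countFin-any≤length : ∀ (xs : List (Fin m)) → countFin (λ l → any (eqFin l) xs) ≤ length xs
  countFin-any≤length []       = ≤-reflexive (countFin-none {m} (λ l → any (eqFin l) []) (λ _ → refl))
  countFin-any≤length (x ∷ xs) = ≤-trans (countFin-∨ (λ l → eqFin l x) (λ l → any (eqFin l) xs))
    (+-mono-≤ (≤-reflexive (trans (countFin-cong (λ l → eqFin-sym l x)) (countFin-eqFin x))) (countFin-any≤length xs))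

-- Counting vectors

∑-allVecs-suc : ∀ m k (f : Vec (Fin m) (suc k) → ℕ) →
                ∑ f (allVecs m (suc k)) ≡ ∑[ x ∈ allFin m ] ∑[ v ∈ allVecs m k ] f (x ∷ᵥ v)
∑-allVecs-suc m k f = trans (∑-concatMap f _ (allFin m)) (∑-cong (λ x → ∑-map f (x ∷ᵥ_) (allVecs m k)) (allFin m))

module _ {m : ℕ} where

  pointwise : List (Fin m → Bool) → List (Fin m) → Bool
  pointwise []       []       = true
  pointwise (p ∷ ps) (x ∷ xs) = p x ∧ pointwise ps xs
  pointwise _        _        = false

  ∏countFin : List (Fin m → Bool) → ℕ
  ∏countFin []       = 1
  ∏countFin (p ∷ ps) = countFin p * ∏countFin ps

  allIn : (Fin m → Bool) → List (Fin m) → Bool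
  allIn p []       = true
  allIn p (x ∷ xs) = p x ∧ allIn p xs

count-allVecs-pointwise : ∀ m k (ps : List (Fin m → Bool)) → length ps ≡ k →
                          count (pointwise ps ∘ toList) (allVecs m k) ≡ ∏countFin ps
count-allVecs-pointwise m zero    []       _     = refl
count-allVecs-pointwise m (suc k) (p ∷ ps) |ps|≡k = begin
  count (pointwise (p ∷ ps) ∘ toList) (allVecs m (suc k))
    ≡⟨ ∑-allVecs-suc m k _ ⟩
  ∑[ x ∈ allFin m ] ∑[ v ∈ allVecs m k ] 𝟙 (p x ∧ pointwise ps (toList v))
    ≡⟨ ∑-cong (λ x → trans (∑-cong (λ v → 𝟙-∧ (p x) _) (allVecs m k)) (∑-*ˡ _ (𝟙 (p x)) (allVecs m k))) (allFin m) ⟩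
  ∑[ x ∈ allFin m ] (𝟙 (p x) * count (pointwise ps ∘ toList) (allVecs m k))
    ≡⟨ ∑-cong (λ x → cong (𝟙 (p x) *_) (count-allVecs-pointwise m k ps (suc-injective |ps|≡k))) (allFin m) ⟩
  ∑[ x ∈ allFin m ] (𝟙 (p x) * ∏countFin ps)
    ≡⟨ ∑-*ʳ (𝟙 ∘ p) (∏countFin ps) (allFin m) ⟩
  count p (allFin m) * ∏countFin ps
    ≡⟨ cong (_* ∏countFin ps) (countFin≡count p) ⟨
  ∏countFin (p ∷ ps) ∎
  where open ≡-Reasoning

module _ {m : ℕ} where

  pointwise-eqFin⇒≡ : ∀ (ys xs : List (Fin m)) → pointwise (map eqFin ys) xs ≡ true → ys ≡ xs
  pointwise-eqFin⇒≡ []       []       _  = refl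
  pointwise-eqFin⇒≡ (y ∷ ys) (x ∷ xs) eq =
    let y≡x , ys≡xs = ∧-true⁻ {eqFin y x} eq in cong₂ _∷_ (eqFin⇒≡ y≡x) (pointwise-eqFin⇒≡ ys xs ys≡xs)

  ∏countFin-eqFin : ∀ (ys : List (Fin m)) → ∏countFin (map eqFin ys) ≡ 1
  ∏countFin-eqFin []       = refl
  ∏countFin-eqFin (y ∷ ys) = cong₂ _*_ (countFin-eqFin y) (∏countFin-eqFin ys)

-- Falling factorials and binomial coefficients

P′≡P : ∀ n k → n P′ k ≡ n P k
P′≡P n k with k ≤ᵇ n in k≤ᵇn
... | true  = refl
... | false = P′-vanishes n k (≰⇒> (λ k≤n → subst T k≤ᵇn (≤⇒≤ᵇ k≤n)))
  where
  P′-vanishes : ∀ n k → n < k → n P′ k ≡ 0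
  P′-vanishes n (suc k) (s≤s n≤k) = cong (_* (n P′ k)) (m≤n⇒m∸n≡0 n≤k)

P-suc-suc : ∀ n k → suc n P suc k ≡ suc n * (n P k)
P-suc-suc n k = trans (sym (P′≡P (suc n) (suc k))) (trans (P′-step n k) (cong (suc n *_) (P′≡P n k)))
  where
  P′-step : ∀ n k → suc n P′ suc k ≡ suc n * (n P′ k)
  P′-step n zero    = refl
  P′-step n (suc k) = begin
    (n ∸ k) * (suc n P′ suc k)     ≡⟨ cong ((n ∸ k) *_) (P′-step n k) ⟩
    (n ∸ k) * (suc n * (n P′ k))   ≡⟨ solve 3 (λ a b c → a :* (b :* c) := b :* (a :* c)) refl (n ∸ k) (suc n) (n P′ k) ⟩
    suc n * ((n ∸ k) * (n P′ k))   ∎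
    where open ≡-Reasoning; open +-*-Solver

P-suc : ∀ n k → n P suc k ≡ n * (pred n P k)
P-suc zero    k = refl
P-suc (suc n) k = P-suc-suc n k

P-pascal : ∀ n t → suc n P suc t ≡ n P suc t + suc t * (n P t)
P-pascal n t with t ≤? n
... | yes t≤n = begin
  suc n P suc t                      ≡⟨ P′≡P (suc n) (suc t) ⟨
  suc n P′ suc t                     ≡⟨ P′-rec (s≤s t≤n) ⟩
  suc t * (n P′ t) + n P′ suc t      ≡⟨ cong₂ (λ a b → suc t * a + b) (P′≡P n t) (P′≡P n (suc t)) ⟩
  suc t * (n P t) + n P suc t        ≡⟨ +-comm (suc t * (n P t)) _ ⟩
  n P suc t + suc t * (n P t)        ∎
  where open ≡-Reasoning
... | no t≰n = begin
  suc n P suc t                      ≡⟨ k>n⇒nPk≡0 (s≤s n<t) ⟩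
  0                                  ≡⟨ *-zeroʳ (suc t) ⟨
  suc t * 0                          ≡⟨ cong₂ (λ a b → a + suc t * b) (k>n⇒nPk≡0 (m<n⇒m<1+n n<t)) (k>n⇒nPk≡0 n<t) ⟨
  n P suc t + suc t * (n P t)        ∎
  where open ≡-Reasoning; n<t = ≰⇒> t≰n

C-absorb : ∀ m t → suc m * (m C t) ≡ suc t * (suc m C suc t)
C-absorb zero    zero    = refl
C-absorb zero    (suc t) = sym (*-zeroʳ (2 + t))
C-absorb (suc m) zero    = trans (*-identityʳ (2 + m)) (sym (trans (*-identityˡ _) (nC1≡n (2 + m))))
C-absorb (suc m) (suc t) = begin
  (2 + m) * a                       ≡⟨⟩
  a + (1 + m) * a                   ≡⟨ cong (λ z → a + (1 + m) * z) (nCk+nC[k+1]≡[n+1]C[k+1] m t) ⟨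
  a + (1 + m) * (b + c)             ≡⟨ cong (a +_) (*-distribˡ-+ (1 + m) b c) ⟩
  a + ((1 + m) * b + (1 + m) * c)   ≡⟨ cong₂ (λ u v → a + (u + v)) (C-absorb m t) (C-absorb m (suc t)) ⟩
  a + ((1 + t) * a + (2 + t) * d)   ≡⟨ sym (+-assoc a _ _) ⟩
  (2 + t) * a + (2 + t) * d         ≡⟨ *-distribˡ-+ (2 + t) a d ⟨
  (2 + t) * (a + d)                 ≡⟨ cong ((2 + t) *_) (nCk+nC[k+1]≡[n+1]C[k+1] (suc m) (suc t)) ⟩
  (2 + t) * ((2 + m) C (2 + t))     ∎
  where
  open ≡-Reasoning
  a = suc m C suc t
  b = m C t
  c = m C suc t
  d = suc m C (2 + t)

allIn-remove : ∀ {m} (S : Fin m → Bool) x xs →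
               allIn (λ y → S y ∧ not (eqFin x y)) xs ≡ allIn S xs ∧ not (any (eqFin x) xs)
allIn-remove S x []       = refl
allIn-remove S x (y ∷ ys) rewrite allIn-remove S x ys with S y | eqFin x y
... | true  | true  = sym (∧-zeroʳ _)
... | true  | false = refl
... | false | _     = refl

count-allVecs-distinct : ∀ m k (S : Fin m → Bool) →
                         count (λ v → allDistinct (toList v) ∧ allIn S (toList v)) (allVecs m k) ≡ countFin S P k
count-allVecs-distinct m zero    S = refl
count-allVecs-distinct m (suc k) S = begin
  count (λ v → allDistinct (toList v) ∧ allIn S (toList v)) (allVecs m (suc k))
    ≡⟨ ∑-allVecs-suc m k _ ⟩
  ∑[ x ∈ allFin m ] ∑[ v ∈ allVecs m k ] 𝟙 (allDistinct (x ∷ toList v) ∧ allIn S (x ∷ toList v))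
    ≡⟨ ∑-cong (λ x → trans (∑-cong (λ v → trans (cong 𝟙 (choose-head x (toList v))) (𝟙-∧ (S x) _)) (allVecs m k))
                           (∑-*ˡ _ (𝟙 (S x)) (allVecs m k))) (allFin m) ⟩
  ∑[ x ∈ allFin m ] (𝟙 (S x) * count (λ v → allDistinct (toList v) ∧ allIn (S-without x) (toList v)) (allVecs m k))
    ≡⟨ ∑-𝟙*-const S _ _ (λ x Sx → trans (count-allVecs-distinct m k (S-without x))
                                         (cong (_P k) (cong pred (sym (countFin-remove S x Sx))))) (allFin m) ⟩
  count S (allFin m) * (pred (countFin S) P k)
    ≡⟨ cong (_* (pred (countFin S) P k)) (countFin≡count S) ⟨
  countFin S * (pred (countFin S) P k)
    ≡⟨ P-suc (countFin S) k ⟨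
  countFin S P suc k ∎
  where
  open ≡-Reasoning
  S-without : Fin m → Fin m → Bool
  S-without x y = S y ∧ not (eqFin x y)
  choose-head : ∀ x xs → allDistinct (x ∷ xs) ∧ allIn S (x ∷ xs) ≡ S x ∧ (allDistinct xs ∧ allIn (S-without x) xs)
  choose-head x xs rewrite allIn-remove S x xs =
    ∧-Solver.prove 4 ((a ⊕ d) ⊕ (s ⊕ i)) (s ⊕ (d ⊕ (i ⊕ a)))
                     (not (any (eqFin x) xs) ∷ᵥ allDistinct xs ∷ᵥ S x ∷ᵥ allIn S xs ∷ᵥ []ᵥ)
    where
    open ∧-Solver
    a = var zero
    d = var (suc zero)
    s = var (suc (suc zero))
    i = var (suc (suc (suc zero)))

-- Sequences taking a prescribed number of values

new-values-base : ∀ r s k → s * ((r C 0) * (k P 0) * (s + 0) ^ k) + r * 0 ≤ (r C 0) * (suc k P 0) * (s + 0) ^ suc k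
new-values-base r s k = ≤-reflexive
  (solve 3 (λ s r x → s :* (con 1 :* con 1 :* x) :+ r :* con 0 := con 1 :* con 1 :* ((s :+ con 0) :* x)) refl s r ((s + 0) ^ k))
  where open +-*-Solver

new-values-step : ∀ r s k t →
  s * ((r C suc t) * (k P suc t) * (s + suc t) ^ (k ∸ suc t)) + r * ((pred r C t) * (k P t) * (suc s + t) ^ (k ∸ t))
    ≤ (r C suc t) * (suc k P suc t) * (s + suc t) ^ (k ∸ t)
new-values-step zero     s k t = ≤-trans (≤-reflexive (trans (+-identityʳ (s * 0)) (*-zeroʳ s))) z≤n
new-values-step (suc r′) s k t = begin
  s * (X * F₁ * c ^ (k ∸ suc t)) + suc r′ * ((r′ C t) * F₀ * (suc s + t) ^ (k ∸ t))
    ≡⟨ cong (λ z → s * (X * F₁ * c ^ (k ∸ suc t)) + suc r′ * ((r′ C t) * F₀ * z ^ (k ∸ t))) (sym (+-suc s t)) ⟩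
  s * (X * F₁ * c ^ (k ∸ suc t)) + suc r′ * ((r′ C t) * F₀ * c ^ (k ∸ t))
    ≡⟨ cong (s * (X * F₁ * c ^ (k ∸ suc t)) +_)
            (solve 4 (λ r b f p → r :* (b :* f :* p) := r :* b :* f :* p) refl (suc r′) (r′ C t) F₀ (c ^ (k ∸ t))) ⟩
  s * (X * F₁ * c ^ (k ∸ suc t)) + suc r′ * (r′ C t) * F₀ * c ^ (k ∸ t)
    ≡⟨ cong (λ z → s * (X * F₁ * c ^ (k ∸ suc t)) + z * F₀ * c ^ (k ∸ t)) (C-absorb r′ t) ⟩
  s * (X * F₁ * c ^ (k ∸ suc t)) + suc t * X * F₀ * c ^ (k ∸ t)
    ≤⟨ +-monoˡ-≤ _ first-term ⟩
  X * F₁ * c ^ (k ∸ t) + suc t * X * F₀ * c ^ (k ∸ t)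
    ≡⟨ solve 5 (λ x f₁ t f₀ p → x :* f₁ :* p :+ t :* x :* f₀ :* p := x :* (f₁ :+ t :* f₀) :* p) refl
               X F₁ (suc t) F₀ (c ^ (k ∸ t)) ⟩
  X * (F₁ + suc t * F₀) * c ^ (k ∸ t)
    ≡⟨ cong (λ z → X * z * c ^ (k ∸ t)) (P-pascal k t) ⟨
  X * (suc k P suc t) * c ^ (k ∸ t) ∎
  where
  open ≤-Reasoning
  open +-*-Solver
  X  = suc r′ C suc t
  F₁ = k P suc t
  F₀ = k P t
  c  = s + suc t
  first-term : s * (X * F₁ * c ^ (k ∸ suc t)) ≤ X * F₁ * c ^ (k ∸ t)
  first-term with t <? k
  ... | yes t<k = begin
    s * (X * F₁ * c ^ (k ∸ suc t))   ≤⟨ *-monoˡ-≤ _ (m≤m+n s (suc t)) ⟩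
    c * (X * F₁ * c ^ (k ∸ suc t))   ≡⟨ solve 4 (λ c x f p → c :* (x :* f :* p) := x :* f :* (c :* p)) refl
                                                c X F₁ (c ^ (k ∸ suc t)) ⟩
    X * F₁ * c ^ suc (k ∸ suc t)     ≡⟨ cong (λ e → X * F₁ * c ^ e) (+-∸-assoc 1 t<k) ⟨
    X * F₁ * c ^ (k ∸ t)             ∎
  ... | no t≮k rewrite k>n⇒nPk≡0 (s≤s (≮⇒≥ t≮k)) =
    ≤-reflexive (trans (cong (λ z → s * (z * c ^ (k ∸ suc t))) (*-zeroʳ X))
                (trans (*-zeroʳ s) (sym (cong (_* c ^ (k ∸ t)) (*-zeroʳ X)))))

module _ {M : ℕ} where

  unionSize : ∀ {k} → (Fin M → Bool) → Vec (Fin M) k → ℕ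
  unionSize S v = countFin (λ l → S l ∨ any (eqFin l) (toList v))

  insert : Fin M → (Fin M → Bool) → Fin M → Bool
  insert x S l = S l ∨ eqFin l x

  unionSize-∷ : ∀ {k} S x (v : Vec (Fin M) k) → unionSize S (x ∷ᵥ v) ≡ unionSize (insert x S) v
  unionSize-∷ S x v = countFin-cong (λ l → sym (∨-assoc (S l) (eqFin l x) _))

  countFin≤unionSize : ∀ {k} S (v : Vec (Fin M) k) → countFin S ≤ unionSize S v
  countFin≤unionSize S v = countFin-mono {M} {S} {λ l → S l ∨ any (eqFin l) (toList v)} (λ x Sx → cong (_∨ _) Sx)

  insert-∈ : ∀ S x → S x ≡ true → ∀ l → insert x S l ≡ S l
  insert-∈ S x Sx l with l Fin.≟ x
  ... | yes refl = trans (cong (_∨ true) Sx) (sym Sx)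
  ... | no _     = ∨-identityʳ (S l)

  countFin-insert-∉ : ∀ S x → S x ≡ false → countFin (insert x S) ≡ suc (countFin S)
  countFin-insert-∉ S x Sx = trans (countFin-remove (insert x S) x (trans (cong (_∨ eqFin x x) Sx) (eqFin-refl x)))
    (cong suc (countFin-cong insert-without-x))
    where
    insert-without-x : ∀ l → insert x S l ∧ not (eqFin x l) ≡ S l
    insert-without-x l with l Fin.≟ x
    ... | yes refl = begin
      (S x ∨ true) ∧ not (eqFin x x)   ≡⟨ cong (λ b → (S x ∨ true) ∧ not b) (eqFin-refl x) ⟩
      (S x ∨ true) ∧ false             ≡⟨ ∧-zeroʳ _ ⟩
      false                            ≡⟨ Sx ⟨
      S x                              ∎
      where open ≡-Reasoning
    ... | no l≢x   = trans (cong (λ b → (S l ∨ false) ∧ not b) (eqFin-≢ (l≢x ∘ sym)))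
                           (trans (∧-identityʳ _) (∨-identityʳ (S l)))

  count-insert-∈ : ∀ {k} S x → S x ≡ true → ∀ c (vs : List (Vec (Fin M) k)) →
                   count (λ v → unionSize (insert x S) v ≡ᵇ c) vs ≡ count (λ v → unionSize S v ≡ᵇ c) vs
  count-insert-∈ S x Sx c = ∑-cong (λ v → cong (λ z → 𝟙 (z ≡ᵇ c)) (countFin-cong (λ l → cong (_∨ _) (insert-∈ S x Sx l))))

  count-insert-∉ : ∀ {k} S x → S x ≡ false → (vs : List (Vec (Fin M) k)) →
                   count (λ v → unionSize (insert x S) v ≡ᵇ countFin S) vs ≡ 0
  count-insert-∉ S x Sx vs = trans (∑-cong (λ v → 𝟙-≡ᵇ-≢ (new-value v)) vs) (∑-zero vs)
    where
    new-value : ∀ v → unionSize (insert x S) v ≢ countFin S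
    new-value v eq = 1+n≰n (begin
      suc (countFin S)              ≡⟨ countFin-insert-∉ S x Sx ⟨
      countFin (insert x S)         ≤⟨ countFin≤unionSize (insert x S) v ⟩
      unionSize (insert x S) v      ≡⟨ eq ⟩
      countFin S                    ∎)
      where open ≤-Reasoning

  -- The first entry is one of the s values of S or one of the M ∸ s others; by C-absorb and
  -- P-pascal the resulting recurrence (new-values-step) is dominated by the bound.
  count-new-values-≤ : ∀ k (S : Fin M → Bool) t →
    count (λ v → unionSize S v ≡ᵇ countFin S + t) (allVecs M k)
      ≤ ((M ∸ countFin S) C t) * (k P t) * (countFin S + t) ^ (k ∸ t)
  count-new-values-≤ zero    S zero    = ≤-trans (≤-reflexive (+-identityʳ _)) (𝟙≤1 _)
    where
    𝟙≤1 : ∀ b → 𝟙 b ≤ 1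
    𝟙≤1 true  = ≤-refl
    𝟙≤1 false = z≤n
  count-new-values-≤ zero    S (suc t) = ≤-trans (≤-reflexive (trans (+-identityʳ _) (𝟙-≡ᵇ-≢ no-new-value))) z≤n
    where
    no-new-value : unionSize S []ᵥ ≢ countFin S + suc t
    no-new-value eq = m+1+n≢m (countFin S) (trans (sym eq) (countFin-cong (λ l → ∨-identityʳ (S l))))
  count-new-values-≤ (suc k) S t = begin
    count (λ v → unionSize S v ≡ᵇ s + t) (allVecs M (suc k))
      ≡⟨ ∑-allVecs-suc M k _ ⟩
    ∑[ x ∈ allFin M ] count (λ v → unionSize S (x ∷ᵥ v) ≡ᵇ s + t) (allVecs M k)
      ≡⟨ ∑-cong (λ x → ∑-cong (λ v → cong (λ z → 𝟙 (z ≡ᵇ s + t)) (unionSize-∷ S x v)) (allVecs M k)) (allFin M) ⟩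
    ∑ rest (allFin M)
      ≤⟨ ∑-split-≤ rest S _ _ rest-∈ (rest-∉ t) (allFin M) ⟩
    count S (allFin M) * bound k s t + count (not ∘ S) (allFin M) * bound-∉ t
      ≡⟨ cong₂ (λ a b → a * bound k s t + b * bound-∉ t) (countFin≡count S) (countFin≡count (not ∘ S)) ⟨
    s * bound k s t + countFin (not ∘ S) * bound-∉ t
      ≡⟨ cong (λ z → s * bound k s t + z * bound-∉ t) (countFin-not S) ⟩
    s * bound k s t + (M ∸ s) * bound-∉ t
      ≤⟨ recurrence t ⟩
    bound (suc k) s t ∎
    where
    open ≤-Reasoning
    s = countFin S
    bound : ℕ → ℕ → ℕ → ℕ
    bound k s t = ((M ∸ s) C t) * (k P t) * (s + t) ^ (k ∸ t)
    rest : Fin M → ℕ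
    rest x = count (λ v → unionSize (insert x S) v ≡ᵇ s + t) (allVecs M k)
    bound-∉ : ℕ → ℕ
    bound-∉ zero     = 0
    bound-∉ (suc t′) = bound k (suc s) t′
    recurrence : ∀ t → s * bound k s t + (M ∸ s) * bound-∉ t ≤ bound (suc k) s t
    recurrence zero     = new-values-base (M ∸ s) s k
    recurrence (suc t′) =
      subst (λ r → s * bound k s (suc t′) + (M ∸ s) * ((r C t′) * (k P t′) * (suc s + t′) ^ (k ∸ t′)) ≤ bound (suc k) s (suc t′))
            (pred[m∸n]≡m∸[1+n] M s) (new-values-step (M ∸ s) s k t′)
    rest-∈ : ∀ x → S x ≡ true → rest x ≤ bound k s t
    rest-∈ x Sx = ≤-trans (≤-reflexive (count-insert-∈ S x Sx (s + t) (allVecs M k))) (count-new-values-≤ k S t)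
    rest-∉ : ∀ t → ∀ x → S x ≡ false → count (λ v → unionSize (insert x S) v ≡ᵇ s + t) (allVecs M k) ≤ bound-∉ t
    rest-∉ zero     x Sx = ≤-reflexive
      (trans (cong (λ z → count (λ v → unionSize (insert x S) v ≡ᵇ z) (allVecs M k)) (+-identityʳ s))
             (count-insert-∉ S x Sx (allVecs M k)))
    rest-∉ (suc t′) x Sx =
      subst (λ z → count (λ v → unionSize (insert x S) v ≡ᵇ z) (allVecs M k) ≤ bound k (suc s) t′) (sym (+-suc s t′))
        (subst (λ z → count (λ v → unionSize (insert x S) v ≡ᵇ z + t′) (allVecs M k) ≤ bound k z t′)
               (countFin-insert-∉ S x Sx) (count-new-values-≤ k (insert x S) t′))

count-distinct-values-≤ : ∀ M k j →
  count (λ v → countFin (λ l → any (eqFin l) (toList v)) ≡ᵇ j) (allVecs M k) ≤ (M C j) * (k P j) * j ^ (k ∸ j)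
count-distinct-values-≤ M k j =
  subst (λ z → count (λ v → countFin (λ l → any (eqFin l) (toList v)) ≡ᵇ z + j) (allVecs M k)
                 ≤ ((M ∸ z) C j) * (k P j) * (z + j) ^ (k ∸ j))
        (countFin-none {M} (λ _ → false) (λ _ → refl))
        (count-new-values-≤ k (λ _ → false) j)

-- Lists and cyclic sequences

any-∈ : ∀ {f : A → Bool} {xs x} → x ∈ xs → f x ≡ true → any f xs ≡ true
any-∈ {f = f} {x′ ∷ xs} (here refl) fx rewrite fx = refl
any-∈ {f = f} {x′ ∷ xs} (there x∈xs) fx with f x′
... | true  = refl
... | false = any-∈ x∈xs fx

any⇒∃ : ∀ {f : A → Bool} xs → any f xs ≡ true → ∃ λ x → x ∈ xs × f x ≡ true
any⇒∃ {f = f} (x ∷ xs) any≡true with f x in fx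
... | true  = x , here refl , fx
... | false = let y , y∈xs , fy = any⇒∃ xs any≡true in y , there y∈xs , fy

any-eqFin⇒∈ : ∀ {m} {x : Fin m} xs → any (eqFin x) xs ≡ true → x ∈ xs
any-eqFin⇒∈ xs any≡true = let y , y∈xs , x≡y = any⇒∃ xs any≡true in subst (_∈ xs) (sym (eqFin⇒≡ x≡y)) y∈xs

module _ {m : ℕ} {S : Fin m → Bool} where

  allIn-∈ : ∀ xs {x} → allIn S xs ≡ true → x ∈ xs → S x ≡ true
  allIn-∈ (x′ ∷ xs) all (here refl)  = proj₁ (∧-true⁻ all)
  allIn-∈ (x′ ∷ xs) all (there x∈xs) = allIn-∈ xs (proj₂ (∧-true⁻ {S x′} all)) x∈xs

  ∈⇒allIn : ∀ xs → (∀ x → x ∈ xs → S x ≡ true) → allIn S xs ≡ true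
  ∈⇒allIn []       _   = refl
  ∈⇒allIn (x ∷ xs) all = ∧-true⁺ (all x (here refl)) (∈⇒allIn xs (λ y → all y ∘ there))

module _ {m : ℕ} {x : Fin m} {xs : List (Fin m)} where

  allDistinct-head : allDistinct (x ∷ xs) ≡ true → x ∉ xs
  allDistinct-head distinct x∈xs with any (eqFin x) xs | any-∈ {f = eqFin x} x∈xs (eqFin-refl x)
  allDistinct-head () x∈xs | true | refl

  allDistinct-tail : allDistinct (x ∷ xs) ≡ true → allDistinct xs ≡ true
  allDistinct-tail distinct = proj₂ (∧-true⁻ {not (any (eqFin x) xs)} distinct)

∈-zip : ∀ {xs : List A} {ys : List B} {a b} → (a , b) ∈ zip xs ys → a ∈ xs × b ∈ ys
∈-zip {xs = x ∷ xs} {y ∷ ys} (here refl) = here refl , here refl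
∈-zip {xs = x ∷ xs} {y ∷ ys} (there p)   = let a∈xs , b∈ys = ∈-zip p in there a∈xs , there b∈ys

∈-zip-++ : ∀ (xs : List A) (ys zs : List B) {c} → c ∈ zip xs ys → c ∈ zip xs (ys ++ zs)
∈-zip-++ (x ∷ xs) (y ∷ ys) zs (here refl) = here refl
∈-zip-++ (x ∷ xs) (y ∷ ys) zs (there p)   = there (∈-zip-++ xs ys zs p)

zip-partner : ∀ (xs : List A) (ys : List B) {a} → a ∈ xs → length xs ≤ length ys → ∃ λ b → (a , b) ∈ zip xs ys
zip-partner (x ∷ xs) (y ∷ ys) (here refl) _          = y , here refl
zip-partner (x ∷ xs) (y ∷ ys) (there a∈xs) (s≤s |xs|≤|ys|) =
  let b , ab∈ = zip-partner xs ys a∈xs |xs|≤|ys| in b , there ab∈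

zip-injective : ∀ {m} (xs : List A) (ys : List (Fin m)) {a a′ y} → allDistinct ys ≡ true →
                (a , y) ∈ zip xs ys → (a′ , y) ∈ zip xs ys → a ≡ a′
zip-injective (x ∷ xs) (y ∷ ys) distinct (here refl) (here refl) = refl
zip-injective (x ∷ xs) (y ∷ ys) distinct (here refl) (there q)   = ⊥-elim (allDistinct-head {x = y} {ys} distinct (proj₂ (∈-zip q)))
zip-injective (x ∷ xs) (y ∷ ys) distinct (there p)   (here refl) = ⊥-elim (allDistinct-head {x = y} {ys} distinct (proj₂ (∈-zip p)))
zip-injective (x ∷ xs) (y ∷ ys) distinct (there p)   (there q)   = zip-injective xs ys (allDistinct-tail {x = y} {ys} distinct) p q

pointwise-zip : ∀ {m} (f : A → Fin m → Bool) (xs : List A) (ys : List (Fin m)) → length xs ≡ length ys →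
                (∀ a y → (a , y) ∈ zip xs ys → f a y ≡ true) → pointwise (map f xs) ys ≡ true
pointwise-zip f []       []       _   _  = refl
pointwise-zip f (x ∷ xs) (y ∷ ys) |≡| ok =
  ∧-true⁺ (ok x y (here refl)) (pointwise-zip f xs ys (suc-injective |≡|) (λ a z → ok a z ∘ there))

module _ {m : ℕ} where

  zip-shift-≢ : ∀ {z t : Fin m} zs {a b} → allDistinct (z ∷ zs) ≡ true → t ∉ z ∷ zs →
                (a , b) ∈ zip (z ∷ zs) (zs ++ [ t ]) → a ≢ b
  zip-shift-≢         []       distinct t∉ (here refl) = λ z≡t → t∉ (here (sym z≡t))
  zip-shift-≢ {z = z} (w ∷ ws) distinct t∉ (here refl) = λ z≡w → allDistinct-head {x = z} {w ∷ ws} distinct (here z≡w)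
  zip-shift-≢ {z = z} (w ∷ ws) distinct t∉ (there p)   =
    zip-shift-≢ ws (allDistinct-tail {x = z} {w ∷ ws} distinct) (t∉ ∘ there) p

  cycPairs-≢ : ∀ {x₀ x₁ : Fin m} rest {a b} → allDistinct (x₀ ∷ x₁ ∷ rest) ≡ true →
               (a , b) ∈ cycPairs (x₀ ∷ x₁ ∷ rest) → a ≢ b
  cycPairs-≢ {x₀} {x₁} rest distinct (here refl) = λ x₀≡x₁ → allDistinct-head {x = x₀} {x₁ ∷ rest} distinct (here x₀≡x₁)
  cycPairs-≢ {x₀} {x₁} rest distinct (there p)   =
    zip-shift-≢ rest (allDistinct-tail {x = x₀} {x₁ ∷ rest} distinct) (allDistinct-head {x = x₀} {x₁ ∷ rest} distinct) p

cycPairs-∈ : ∀ (xs : List A) {a b} → (a , b) ∈ cycPairs xs → a ∈ xs × b ∈ xs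
cycPairs-∈ (x ∷ xs) p with ∈-zip p
... | a∈ , b∈ with ∈-++⁻ xs b∈
...   | inj₁ b∈xs        = a∈ , there b∈xs
...   | inj₂ (here refl) = a∈ , here refl

cycPairs-from : ∀ (xs : List A) {a} → a ∈ xs → ∃ λ b → (a , b) ∈ cycPairs xs
cycPairs-from (x ∷ xs) a∈ =
  zip-partner (x ∷ xs) (xs ++ [ x ]) a∈ (≤-reflexive (sym (trans (List.length-++ xs) (+-comm (length xs) 1))))

lastOf : A → List A → A
lastOf d []       = d
lastOf d (x ∷ xs) = lastOf x xs

adjacentPairs : List A → List (A × A)
adjacentPairs (x ∷ y ∷ ys) = (x , y) ∷ adjacentPairs (y ∷ ys)
adjacentPairs _            = []

-- (xₖ , x₁) ∷ (x₁ , x₂) ∷ … ∷ (xₖ₋₁ , xₖ): for the sides of a polygon, the i-th pair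
-- consists of the two sides at its i-th vertex.
cornerPairs : List A → List (A × A)
cornerPairs []       = []
cornerPairs (x ∷ xs) = adjacentPairs (lastOf x xs ∷ x ∷ xs)

lastOf-∈ : ∀ (d : A) xs → lastOf d xs ∈ d ∷ xs
lastOf-∈ d []       = here refl
lastOf-∈ d (x ∷ xs) = there (lastOf-∈ x xs)

adjacentPairs-∈ : ∀ {a b : A} x xs → (a , b) ∈ adjacentPairs (x ∷ xs) → a ∈ x ∷ xs × b ∈ xs
adjacentPairs-∈ x (y ∷ ys) (here refl) = here refl , here refl
adjacentPairs-∈ x (y ∷ ys) (there p)   = let a∈ , b∈ = adjacentPairs-∈ y ys p in there a∈ , there b∈

cornerPairs-∈ : ∀ {a b : A} xs → (a , b) ∈ cornerPairs xs → a ∈ xs × b ∈ xs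
cornerPairs-∈ (x ∷ xs) p with adjacentPairs-∈ (lastOf x xs) (x ∷ xs) p
... | here refl , b∈ = lastOf-∈ x xs , b∈
... | there a∈  , b∈ = a∈ , b∈

length-adjacentPairs : ∀ (x : A) xs → length (adjacentPairs (x ∷ xs)) ≡ length xs
length-adjacentPairs x []       = refl
length-adjacentPairs x (y ∷ ys) = cong suc (length-adjacentPairs y ys)

length-cornerPairs : ∀ (xs : List A) → length (cornerPairs xs) ≡ length xs
length-cornerPairs []       = refl
length-cornerPairs (x ∷ xs) = length-adjacentPairs (lastOf x xs) (x ∷ xs)

cycPairs≡adjacentPairs : ∀ (x : A) xs → cycPairs (x ∷ xs) ≡ adjacentPairs (x ∷ xs ++ [ x ])
cycPairs≡adjacentPairs x xs = go x xs x
  where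
  go : ∀ (x : A) xs t → zip (x ∷ xs) (xs ++ [ t ]) ≡ adjacentPairs (x ∷ xs ++ [ t ])
  go x []       t = refl
  go x (y ∷ ys) t = cong ((x , y) ∷_) (go y ys t)

module _ {m : ℕ} (l : Fin m) where

  adjacent-entry : ∀ z zs → z ≢ l → l ∈ zs → ∃ λ a → (a , l) ∈ adjacentPairs (z ∷ zs) × a ≢ l
  adjacent-entry z (w ∷ ws) z≢l (here refl) = z , here refl , z≢l
  adjacent-entry z (w ∷ ws) z≢l (there l∈ws) with w Fin.≟ l
  ... | yes refl = z , here refl , z≢l
  ... | no w≢l   = let a , p , a≢l = adjacent-entry w ws w≢l l∈ws in a , there p , a≢l

  adjacent-entry-last : ∀ e es {y} → lastOf e es ≡ l → y ∈ e ∷ es → y ≢ l →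
                        ∃ λ a → (a , l) ∈ adjacentPairs (e ∷ es) × a ≢ l
  adjacent-entry-last e []       refl (here refl) y≢l = ⊥-elim (y≢l refl)
  adjacent-entry-last e (f ∷ fs) last≡l y∈ y≢l with e Fin.≟ l
  ... | no e≢l   = adjacent-entry e (f ∷ fs) e≢l (subst (_∈ f ∷ fs) last≡l (lastOf-∈ f fs))
  ... | yes refl with y∈
  ...   | here refl = ⊥-elim (y≢l refl)
  ...   | there y∈′ = let a , p , a≢l = adjacent-entry-last f fs last≡l y∈′ y≢l in a , there p , a≢l

  adjacent-exit : ∀ z zs {y} → z ≡ l → y ∈ zs → y ≢ l → ∃ λ b → (l , b) ∈ adjacentPairs (z ∷ zs) × b ≢ l
  adjacent-exit z (w ∷ ws) refl y∈ y≢l with w Fin.≟ l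
  ... | no w≢l   = w , here refl , w≢l
  ... | yes refl with y∈
  ...   | here refl = ⊥-elim (y≢l refl)
  ...   | there y∈′ = let b , p , b≢l = adjacent-exit w ws refl y∈′ y≢l in b , there p , b≢l

  adjacent-exit-last : ∀ e es → lastOf e es ≢ l → l ∈ e ∷ es → ∃ λ b → (l , b) ∈ adjacentPairs (e ∷ es) × b ≢ l
  adjacent-exit-last e []       last≢l (here refl) = ⊥-elim (last≢l refl)
  adjacent-exit-last e (f ∷ fs) last≢l l∈ with e Fin.≟ l
  ... | yes refl = adjacent-exit e (f ∷ fs) refl (lastOf-∈ f fs) last≢l
  ... | no e≢l with l∈
  ...   | here refl = ⊥-elim (e≢l refl)
  ...   | there l∈′ = let b , p , b≢l = adjacent-exit-last f fs last≢l l∈′ in b , there p , b≢l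

  cornerPairs-entry : ∀ xs {y} → l ∈ xs → y ∈ xs → y ≢ l → ∃ λ a → (a , l) ∈ cornerPairs xs × a ≢ l
  cornerPairs-entry (e ∷ es) l∈ y∈ y≢l with lastOf e es Fin.≟ l
  ... | no last≢l  = adjacent-entry (lastOf e es) (e ∷ es) last≢l l∈
  ... | yes last≡l = let a , p , a≢l = adjacent-entry-last e es last≡l y∈ y≢l in a , there p , a≢l

  cornerPairs-exit : ∀ xs {y} → l ∈ xs → y ∈ xs → y ≢ l → ∃ λ b → (l , b) ∈ cornerPairs xs × b ≢ l
  cornerPairs-exit (e ∷ es) l∈ y∈ y≢l with lastOf e es Fin.≟ l
  ... | yes last≡l = adjacent-exit (lastOf e es) (e ∷ es) last≡l y∈ y≢l
  ... | no last≢l  = let b , p , b≢l = adjacent-exit-last e es last≢l l∈ in b , there p , b≢l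

adjacent-sides : ∀ (J : A × A → B) u xs {a b x} → ((a , b) , x) ∈ zip (adjacentPairs (map J (adjacentPairs (u ∷ xs)))) xs →
                 ∃ λ u′ → ∃ λ w → (u′ , x) ∈ adjacentPairs (u ∷ xs) × (x , w) ∈ adjacentPairs (u ∷ xs)
                                × a ≡ J (u′ , x) × b ≡ J (x , w)
adjacent-sides J u (v ∷ w ∷ xs) (here refl) = u , w , here refl , there (here refl) , refl , refl
adjacent-sides J u (v ∷ w ∷ xs) (there p)   =
  let u′ , w′ , p₁ , p₂ , a≡ , b≡ = adjacent-sides J v (w ∷ xs) p in u′ , w′ , there p₁ , there p₂ , a≡ , b≡

firstWith : (A → Bool) → List A → Maybe A
firstWith p []       = nothing
firstWith p (x ∷ xs) = if p x then just x else firstWith p xs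

firstWith-just : ∀ (p : A → Bool) xs {y} → firstWith p xs ≡ just y → y ∈ xs × p y ≡ true
firstWith-just p (x ∷ xs) eq with p x in px
firstWith-just p (x ∷ xs) refl | true  = here refl , px
... | false = let y∈ , py = firstWith-just p xs eq in there y∈ , py

firstWith-∈ : ∀ (p : A → Bool) xs {x} → x ∈ xs → p x ≡ true → ∃ λ y → firstWith p xs ≡ just y
firstWith-∈ p (x ∷ xs) x∈ px with p x in px′
firstWith-∈ p (x ∷ xs) x∈           px | true  = x , refl
firstWith-∈ p (x ∷ xs) (here refl)  px | false with () ← trans (sym px) px′
firstWith-∈ p (x ∷ xs) (there x∈xs) px | false = firstWith-∈ p xs x∈xs px

module _ {m : ℕ} where

  isFree : Fin m × Fin m → Bool
  isFree c = eqFin (proj₁ c) (proj₂ c)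

  distinct≤changes : ∀ (xs : List (Fin m)) → 2 ≤ countFin (λ l → any (eqFin l) xs) →
                     countFin (λ l → any (eqFin l) xs) ≤ count (not ∘ isFree) (cornerPairs xs)
  distinct≤changes xs 2≤distinct = begin
    countFin (λ l → any (eqFin l) xs)          ≤⟨ countFin-mono entered ⟩
    countFin (λ l → any (eqFin l) targets)     ≤⟨ countFin-any≤length targets ⟩
    length targets                             ≡⟨ List.length-map proj₂ changes ⟩
    length changes                             ≡⟨ length-filter≡count (not ∘ isFree) (cornerPairs xs) ⟩
    count (not ∘ isFree) (cornerPairs xs)      ∎
    where
    open ≤-Reasoning
    changes = filter (λ c → not (isFree c) Bool.≟ true) (cornerPairs xs)
    targets = map proj₂ changes
    entered : ∀ l → any (eqFin l) xs ≡ true → any (eqFin l) targets ≡ true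
    entered l l∈ =
      let y , y∈ , y≢l = countFin-≥2⇒≢ (λ l → any (eqFin l) xs) l 2≤distinct
          a , al∈ , a≢l = cornerPairs-entry l xs (any-eqFin⇒∈ xs l∈) (any-eqFin⇒∈ xs y∈) y≢l
      in any-∈ (∈-map⁺ proj₂ (∈-filter⁺ (λ c → not (isFree c) Bool.≟ true) al∈ (cong not (eqFin-≢ a≢l)))) (eqFin-refl l)

-- Projective planes

module Plane {n : ℕ} (Π : ProjectivePlane n) where

  open ProjectivePlane Π

  Point Line : Set
  Point = Fin (N n)
  Line  = Fin (N n)

  onLine : Line → Point → Bool
  onLine l x = x I l

  on-join₁ : ∀ {a b : Point} → a ≢ b → (a I join a b) ≡ true
  on-join₁ a≢b = T⇒≡true (proj₁ (join-inc _ _ a≢b))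

  on-join₂ : ∀ {a b : Point} → a ≢ b → (b I join a b) ≡ true
  on-join₂ a≢b = T⇒≡true (proj₂ (join-inc _ _ a≢b))

  join-unique : ∀ {a b : Point} {l : Line} → a ≢ b → (a I l) ≡ true → (b I l) ≡ true → l ≡ join a b
  join-unique a≢b a∈l b∈l = join-uniq _ _ _ a≢b (≡true⇒T a∈l) (≡true⇒T b∈l)

  meet-unique : ∀ {l l′ : Line} {x y : Point} → l ≢ l′ →
                (x I l) ≡ true → (x I l′) ≡ true → (y I l) ≡ true → (y I l′) ≡ true → x ≡ y
  meet-unique {x = x} {y} l≢l′ x∈l x∈l′ y∈l y∈l′ with x Fin.≟ y
  ... | yes x≡y = x≡y
  ... | no x≢y  = ⊥-elim (l≢l′ (trans (join-unique x≢y x∈l y∈l) (sym (join-unique x≢y x∈l′ y∈l′))))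

  sideOf : Point × Point → Line
  sideOf c = join (proj₁ c) (proj₂ c)

  sides : List Point → List Line
  sides p = map sideOf (cycPairs p)

  numLines≡distinct-sides : ∀ {k} (G : Vec Point k) → numLines Π G ≡ countFin (λ l → any (eqFin l) (sides (toList G)))
  numLines≡distinct-sides G = countFin-cong (λ l → sym (any-map (eqFin l) (cycPairs (toList G))))
    where
    any-map : ∀ (f : Line → Bool) cs → any f (map sideOf cs) ≡ any (f ∘ sideOf) cs
    any-map f []       = refl
    any-map f (c ∷ cs) = cong (f (sideOf c) ∨_) (any-map f cs)

  side-∈ : ∀ p {c} → c ∈ cycPairs p → any (eqFin (sideOf c)) (sides p) ≡ true
  side-∈ p {c} c∈ = any-∈ (∈-map⁺ sideOf c∈) (eqFin-refl (sideOf c))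

  ∈-sides : ∀ p {l} → any (eqFin l) (sides p) ≡ true → ∃ λ c → c ∈ cycPairs p × l ≡ sideOf c
  ∈-sides p l∈ = ∈-map⁻ sideOf (any-eqFin⇒∈ (sides p) l∈)

  module Collinear (x₀ x₁ : Point) (rest : List Point) (distinct : allDistinct (x₀ ∷ x₁ ∷ rest) ≡ true) where

    private
      p  = x₀ ∷ x₁ ∷ rest
      l₀ = join x₀ x₁

    side≡l₀ : ∀ {c} → c ∈ cycPairs p → allIn (onLine l₀) p ≡ true → sideOf c ≡ l₀
    side≡l₀ c∈ collinear = let a∈ , b∈ = cycPairs-∈ p c∈ in
      sym (join-unique (cycPairs-≢ rest distinct c∈)
                       (allIn-∈ {S = onLine l₀} p collinear a∈) (allIn-∈ {S = onLine l₀} p collinear b∈))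

    through-all⇒l₀ : ∀ l → allIn (onLine l) p ≡ true → l ≡ l₀
    through-all⇒l₀ l on-l = join-unique (λ x₀≡x₁ → allDistinct-head {x = x₀} {x₁ ∷ rest} distinct (here x₀≡x₁))
                                        (allIn-∈ {S = onLine l} p on-l (here refl)) (allIn-∈ {S = onLine l} p on-l (there (here refl)))

    countFin-lines-through : countFin (λ l → allIn (onLine l) p) ≡ 𝟙 (allIn (onLine l₀) p)
    countFin-lines-through with allIn (onLine l₀) p in collinear
    ... | true  = countFin≡1 (λ l → allIn (onLine l) p) l₀ collinear through-all⇒l₀
    ... | false = countFin-none (λ l → allIn (onLine l) p) none
      where
      none : ∀ l → allIn (onLine l) p ≡ false
      none l with allIn (onLine l) p in on-l
      ... | false = refl
      ... | true with () ← trans (sym collinear) (subst (λ l → allIn (onLine l) p ≡ true) (through-all⇒l₀ l on-l) on-l)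

    collinear≡one-side : allIn (onLine l₀) p ≡ (countFin (λ l → any (eqFin l) (sides p)) ≡ᵇ 1)
    collinear≡one-side = ≡-by-true collinear⇒one-side one-side⇒collinear
      where
      #sides = countFin (λ l → any (eqFin l) (sides p))
      l₀-side : any (eqFin l₀) (sides p) ≡ true
      l₀-side = side-∈ p (here refl)
      collinear⇒one-side : allIn (onLine l₀) p ≡ true → (#sides ≡ᵇ 1) ≡ true
      collinear⇒one-side collinear = T⇒≡true (≡⇒≡ᵇ #sides 1 (countFin≡1 _ l₀ l₀-side only-l₀))
        where
        only-l₀ : ∀ l → any (eqFin l) (sides p) ≡ true → l ≡ l₀
        only-l₀ l l∈ = let c , c∈ , l≡c = ∈-sides p l∈ in trans l≡c (side≡l₀ c∈ collinear)
      one-side⇒collinear : (#sides ≡ᵇ 1) ≡ true → allIn (onLine l₀) p ≡ true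
      one-side⇒collinear one-side = ∈⇒allIn p on-l₀
        where
        side-is-l₀ : ∀ {c} → c ∈ cycPairs p → sideOf c ≡ l₀
        side-is-l₀ {c} c∈ with sideOf c Fin.≟ l₀
        ... | yes c≡l₀ = c≡l₀
        ... | no c≢l₀  = ⊥-elim (<⇒≱ (countFin-≥2 _ (sideOf c) l₀ (side-∈ p c∈) l₀-side c≢l₀)
                                       (≤-reflexive (≡ᵇ⇒≡ #sides 1 (≡true⇒T one-side))))
        on-l₀ : ∀ x → x ∈ p → (x I l₀) ≡ true
        on-l₀ x x∈ = let y , xy∈ = cycPairs-from p x∈ in
          subst (λ l → (x I l) ≡ true) (side-is-l₀ xy∈) (on-join₁ (cycPairs-≢ rest distinct xy∈))

  one-line-indicator : ∀ {k} (G : Vec Point (2 + k)) →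
    𝟙 (isQuasiGon Π G ∧ (numLines Π G ≡ᵇ 1))
      ≡ ∑[ l ∈ allFin (N n) ] 𝟙 (allDistinct (toList G) ∧ allIn (onLine l) (toList G))
  one-line-indicator G@(x₀ ∷ᵥ x₁ ∷ᵥ v) with allDistinct (x₀ ∷ x₁ ∷ toList v) in distinct
  ... | false = sym (∑-zero (allFin (N n)))
  ... | true  = begin
    𝟙 (numLines Π G ≡ᵇ 1)                                        ≡⟨ cong (λ z → 𝟙 (z ≡ᵇ 1)) (numLines≡distinct-sides G) ⟩
    𝟙 (countFin (λ l → any (eqFin l) (sides p)) ≡ᵇ 1)            ≡⟨ cong 𝟙 collinear≡one-side ⟨
    𝟙 (allIn (onLine (join x₀ x₁)) p)                             ≡⟨ countFin-lines-through ⟨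
    countFin (λ l → allIn (onLine l) p)                           ≡⟨ countFin≡count (λ l → allIn (onLine l) p) ⟩
    count (λ l → allIn (onLine l) p) (allFin (N n))               ∎
    where
    open ≡-Reasoning
    open Collinear x₀ x₁ (toList v) distinct
    p = x₀ ∷ x₁ ∷ toList v

  Qcount-one-line : ∀ k → Qcount Π (2 + k) 1 ≡ N n * ((n + 1) P (2 + k))
  Qcount-one-line k = begin
    Qcount Π (2 + k) 1
      ≡⟨ length-filter≡count _ (allVecs (N n) (2 + k)) ⟩
    ∑[ G ∈ allVecs (N n) (2 + k) ] 𝟙 (isQuasiGon Π G ∧ (numLines Π G ≡ᵇ 1))
      ≡⟨ ∑-cong one-line-indicator (allVecs (N n) (2 + k)) ⟩
    ∑[ G ∈ allVecs (N n) (2 + k) ] ∑[ l ∈ allFin (N n) ] 𝟙 (allDistinct (toList G) ∧ allIn (onLine l) (toList G))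
      ≡⟨ ∑-comm _ (allVecs (N n) (2 + k)) (allFin (N n)) ⟩
    ∑[ l ∈ allFin (N n) ] count (λ G → allDistinct (toList G) ∧ allIn (onLine l) (toList G)) (allVecs (N n) (2 + k))
      ≡⟨ ∑-cong (λ l → trans (count-allVecs-distinct (N n) (2 + k) (onLine l)) (cong (_P (2 + k)) (line-size l))) (allFin (N n)) ⟩
    ∑[ l ∈ allFin (N n) ] (suc n P (2 + k))
      ≡⟨ ∑-const _ (allFin (N n)) ⟩
    length (allFin (N n)) * (suc n P (2 + k))
      ≡⟨ cong₂ (λ a b → a * (b P (2 + k))) (List.length-tabulate {n = N n} id) (+-comm 1 n) ⟩
    N n * ((n + 1) P (2 + k)) ∎
    where open ≡-Reasoning

  meetPoint : Line → Line → Maybe Point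
  meetPoint a b with a Fin.≟ b
  ... | yes _   = nothing
  ... | no a≢b  = just (proj₁ (meet a b a≢b))

  meetPoint-on : ∀ a b {y} → meetPoint a b ≡ just y → (y I a) ≡ true × (y I b) ≡ true
  meetPoint-on a b eq with a Fin.≟ b
  meetPoint-on a b refl | no a≢b = let _ , on-a , on-b = meet a b a≢b in T⇒≡true on-a , T⇒≡true on-b

  meetPoint-unique : ∀ {a b y} → a ≢ b → (y I a) ≡ true → (y I b) ≡ true → meetPoint a b ≡ just y
  meetPoint-unique {a} {b} a≢b y∈a y∈b with a Fin.≟ b
  ... | yes a≡b  = ⊥-elim (a≢b a≡b)
  ... | no a≢b′  = let _ , on-a , on-b = meet a b a≢b′ in
                   cong just (meet-unique a≢b (T⇒≡true on-a) (T⇒≡true on-b) y∈a y∈b)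

  isEntry isExit : Line → Line × Line → Bool
  isEntry l c = not (eqFin (proj₁ c) l) ∧ eqFin (proj₂ c) l
  isExit  l c = eqFin (proj₁ c) l ∧ not (eqFin (proj₂ c) l)

  cornerPoint : Maybe (Line × Line) → Maybe Point
  cornerPoint (just c) = meetPoint (proj₁ c) (proj₂ c)
  cornerPoint nothing  = nothing

  entryPoint exitPoint : List (Line × Line) → Line → Maybe Point
  entryPoint cs l = cornerPoint (firstWith (isEntry l) cs)
  exitPoint  cs l = cornerPoint (firstWith (isExit l) cs)

  avoids : Maybe Point → Maybe Point → Point → Bool
  avoids (just y) (just z) x = not (eqFin y z) ∧ (not (eqFin y x) ∧ not (eqFin z x))
  avoids _        _        x = false

  onBoth : Line → Line → Point → Bool
  onBoth a b x = (x I a) ∧ (x I b)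

  freeCorner : List (Line × Line) → Line → Point → Bool
  freeCorner cs l x = (x I l) ∧ avoids (entryPoint cs l) (exitPoint cs l) x

  cornerConstraint : List (Line × Line) → Line × Line → Point → Bool
  cornerConstraint cs c = if isFree c then freeCorner cs (proj₁ c) else onBoth (proj₁ c) (proj₂ c)

  constraints : List Line → List (Point → Bool)
  constraints ℓ = map (cornerConstraint (cornerPairs ℓ)) (cornerPairs ℓ)

  countFin-onBoth : ∀ a b → a ≢ b → countFin (onBoth a b) ≤ 1
  countFin-onBoth a b a≢b = let y , y∈a , y∈b = meet a b a≢b in
    countFin-≤1 (onBoth a b) y (λ x on → let x∈a , x∈b = ∧-true⁻ {x I a} on in
                                          meet-unique a≢b x∈a x∈b (T⇒≡true y∈a) (T⇒≡true y∈b))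

  cornerPoint-on : ∀ (p : Line × Line → Bool) cs {y} → cornerPoint (firstWith p cs) ≡ just y →
                   ∃ λ c → p c ≡ true × (y I proj₁ c) ≡ true × (y I proj₂ c) ≡ true
  cornerPoint-on p cs eq with firstWith p cs in first
  ... | just c = c , proj₂ (firstWith-just p cs first) , meetPoint-on (proj₁ c) (proj₂ c) eq

  entryPoint-on : ∀ cs l {y} → entryPoint cs l ≡ just y → (y I l) ≡ true
  entryPoint-on cs l {y} eq = let c , entry , _ , y∈c₂ = cornerPoint-on (isEntry l) cs eq in
    subst (λ l → (y I l) ≡ true) (eqFin⇒≡ (proj₂ (∧-true⁻ {not (eqFin (proj₁ c) l)} entry))) y∈c₂

  exitPoint-on : ∀ cs l {y} → exitPoint cs l ≡ just y → (y I l) ≡ true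
  exitPoint-on cs l {y} eq = let c , exit , y∈c₁ , _ = cornerPoint-on (isExit l) cs eq in
    subst (λ l → (y I l) ≡ true) (eqFin⇒≡ (proj₁ (∧-true⁻ {eqFin (proj₁ c) l} exit))) y∈c₁

  countFin-freeCorner : ∀ cs l → countFin (freeCorner cs l) ≤ n ∸ 1
  countFin-freeCorner cs l with entryPoint cs l in entry | exitPoint cs l in exit
  ... | nothing | _       = ≤-trans (≤-reflexive (countFin-none _ (λ x → ∧-zeroʳ (x I l)))) z≤n
  ... | just y  | nothing = ≤-trans (≤-reflexive (countFin-none _ (λ x → ∧-zeroʳ (x I l)))) z≤n
  ... | just y  | just z with eqFin y z in y≟z
  ...   | true  = ≤-trans (≤-reflexive (countFin-none _ (λ x → ∧-zeroʳ (x I l)))) z≤n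
  ...   | false = begin
    countFin (λ x → (x I l) ∧ (true ∧ (not (eqFin y x) ∧ not (eqFin z x))))  ≤⟨ countFin-mono avoiding ⟩
    countFin (λ x → ((x I l) ∧ not (eqFin y x)) ∧ not (eqFin z x))           ≡⟨ cong pred (suc-injective two-removed) ⟨
    n ∸ 1                                                                      ∎
    where
    open ≤-Reasoning
    avoiding : ∀ x → (x I l) ∧ (true ∧ (not (eqFin y x) ∧ not (eqFin z x))) ≡ true →
               ((x I l) ∧ not (eqFin y x)) ∧ not (eqFin z x) ≡ true
    avoiding x h with x I l | eqFin y x | eqFin z x
    ... | true | false | false = refl
    two-removed : suc n ≡ suc (suc (countFin (λ x → ((x I l) ∧ not (eqFin y x)) ∧ not (eqFin z x))))
    two-removed = begin-equality
      suc n                                          ≡⟨ line-size l ⟨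
      countFin (onLine l)                            ≡⟨ countFin-remove (onLine l) y (entryPoint-on cs l entry) ⟩
      suc (countFin (λ x → (x I l) ∧ not (eqFin y x)))
        ≡⟨ cong suc (countFin-remove _ z (∧-true⁺ (exitPoint-on cs l exit) (cong not y≟z))) ⟩
      suc (suc (countFin (λ x → ((x I l) ∧ not (eqFin y x)) ∧ not (eqFin z x)))) ∎

  ∏countFin-constraints : ∀ cs ps → ∏countFin (map (cornerConstraint cs) ps) ≤ (n ∸ 1) ^ count isFree ps
  ∏countFin-constraints cs []       = ≤-refl
  ∏countFin-constraints cs (c ∷ ps) with isFree c in free
  ... | true  = *-mono-≤ (countFin-freeCorner cs (proj₁ c)) (∏countFin-constraints cs ps)
  ... | false = ≤-trans (*-mono-≤ (countFin-onBoth (proj₁ c) (proj₂ c) (eqFin-false⇒≢ free)) (∏countFin-constraints cs ps))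
                        (≤-reflexive (+-identityʳ _))

  length-sides : ∀ p → length (sides p) ≡ length p
  length-sides []       = refl
  length-sides (x ∷ xs) = begin
    length (sides (x ∷ xs))                   ≡⟨ List.length-map sideOf (cycPairs (x ∷ xs)) ⟩
    length (cycPairs (x ∷ xs))                ≡⟨ cong length (cycPairs≡adjacentPairs x xs) ⟩
    length (adjacentPairs (x ∷ xs ++ [ x ]))  ≡⟨ length-adjacentPairs x (xs ++ [ x ]) ⟩
    length (xs ++ [ x ])                      ≡⟨ trans (List.length-++ xs) (+-comm (length xs) 1) ⟩
    suc (length xs)                           ∎
    where open ≡-Reasoning

  lastOf-sides : ∀ d x ys t → lastOf d (map sideOf (adjacentPairs (x ∷ ys ++ [ t ]))) ≡ sideOf (lastOf x ys , t)
  lastOf-sides d x []       t = refl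
  lastOf-sides d x (y ∷ ys) t = lastOf-sides (sideOf (x , y)) y ys t

  module Polygon (x₀ x₁ : Point) (rest : List Point) (distinct : allDistinct (x₀ ∷ x₁ ∷ rest) ≡ true)
                 (two-sides : 2 ≤ countFin (λ l → any (eqFin l) (sides (x₀ ∷ x₁ ∷ rest)))) where

    private
      p    = x₀ ∷ x₁ ∷ rest
      ℓ    = sides p
      cs   = cornerPairs ℓ
      u    = lastOf x₁ rest
      walk = x₀ ∷ x₁ ∷ rest ++ [ x₀ ]

    corners≡ : cs ≡ adjacentPairs (map sideOf (adjacentPairs (u ∷ walk)))
    corners≡ = trans (cong cornerPairs (cong (map sideOf) (cycPairs≡adjacentPairs x₀ (x₁ ∷ rest))))
      (cong (λ z → adjacentPairs (z ∷ map sideOf (adjacentPairs walk))) (lastOf-sides (sideOf (x₀ , x₁)) x₁ rest x₀))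

    length-corners : length cs ≡ length p
    length-corners = trans (length-cornerPairs ℓ) (length-sides p)

    walk-step-≢ : ∀ {c e} → (c , e) ∈ adjacentPairs (u ∷ walk) → c ≢ e
    walk-step-≢ (here refl) = λ u≡x₀ →
      allDistinct-head {x = x₀} {x₁ ∷ rest} distinct (subst (_∈ x₁ ∷ rest) u≡x₀ (lastOf-∈ x₁ rest))
    walk-step-≢ {c} {e} (there q) = cycPairs-≢ rest distinct (subst ((c , e) ∈_) (sym (cycPairs≡adjacentPairs x₀ (x₁ ∷ rest))) q)

    on-corner-sides : ∀ {a b x} → ((a , b) , x) ∈ zip cs p → (x I a) ≡ true × (x I b) ≡ true
    on-corner-sides {a} {b} {x} c∈
      with adjacent-sides sideOf u walk (subst (λ z → ((a , b) , x) ∈ zip z walk) corners≡ (∈-zip-++ cs p [ x₀ ] c∈))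
    ... | _ , _ , p₁ , p₂ , refl , refl = on-join₂ (walk-step-≢ p₁) , on-join₁ (walk-step-≢ p₂)

    vertex-of : ∀ {c} → c ∈ cs → ∃ λ y → (c , y) ∈ zip cs p
    vertex-of c∈ = zip-partner cs p c∈ (≤-reflexive length-corners)

    corner-injective : ∀ {c c′ y} → (c , y) ∈ zip cs p → (c′ , y) ∈ zip cs p → c ≡ c′
    corner-injective = zip-injective cs p distinct

    vertices-≢ : ∀ {c c′ y z} → (c , y) ∈ zip cs p → (c′ , z) ∈ zip cs p → c ≢ c′ → not (eqFin y z) ≡ true
    vertices-≢ {y = y} {z} y∈ z∈ c≢c′ with y Fin.≟ z
    ... | yes refl = ⊥-elim (c≢c′ (corner-injective y∈ z∈))
    ... | no _     = refl

    first-corner-vertex : ∀ (q : Line × Line → Bool) {c₀} → c₀ ∈ cs → q c₀ ≡ true →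
                          (∀ c → q c ≡ true → proj₁ c ≢ proj₂ c) →
                          ∃ λ c → ∃ λ y → cornerPoint (firstWith q cs) ≡ just y × (c , y) ∈ zip cs p × q c ≡ true
    first-corner-vertex q c₀∈ qc₀ q⇒≢ with firstWith-∈ q cs c₀∈ qc₀
    ... | c , first with firstWith-just q cs first
    ...   | c∈ , qc with vertex-of c∈
    ...     | y , cy∈ = c , y , trans (cong cornerPoint first) (meetPoint-unique (q⇒≢ c qc) y∈c₁ y∈c₂) , cy∈ , qc
      where
      y∈c₁ = proj₁ (on-corner-sides cy∈)
      y∈c₂ = proj₂ (on-corner-sides cy∈)

    entry⇒≢ : ∀ l c → isEntry l c ≡ true → proj₁ c ≢ proj₂ c
    entry⇒≢ l c entry c₁≡c₂ = let c₁≢l , c₂≡l = ∧-true⁻ {not (eqFin (proj₁ c) l)} entry in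
      eqFin-false⇒≢ (not-true⇒false c₁≢l) (trans c₁≡c₂ (eqFin⇒≡ c₂≡l))

    exit⇒≢ : ∀ l c → isExit l c ≡ true → proj₁ c ≢ proj₂ c
    exit⇒≢ l c exit c₁≡c₂ = let c₁≡l , c₂≢l = ∧-true⁻ {eqFin (proj₁ c) l} exit in
      eqFin-false⇒≢ (not-true⇒false c₂≢l) (trans (sym c₁≡c₂) (eqFin⇒≡ c₁≡l))

    free-corner-satisfied : ∀ {l x} → ((l , l) , x) ∈ zip cs p → freeCorner cs l x ≡ true
    free-corner-satisfied {l} {x} cx∈
      with countFin-≥2⇒≢ (λ l → any (eqFin l) ℓ) l two-sides
    ... | y , y∈ℓ , y≢l
      with cornerPairs-entry l ℓ l∈ℓ (any-eqFin⇒∈ ℓ y∈ℓ) y≢l | cornerPairs-exit l ℓ l∈ℓ (any-eqFin⇒∈ ℓ y∈ℓ) y≢l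
      where l∈ℓ = proj₁ (cornerPairs-∈ ℓ (proj₁ (∈-zip cx∈)))
    ... | a , al∈ , a≢l | b , lb∈ , b≢l
      with first-corner-vertex (isEntry l) al∈ (∧-true⁺ (cong not (eqFin-≢ a≢l)) (eqFin-refl l)) (entry⇒≢ l)
         | first-corner-vertex (isExit l) lb∈ (∧-true⁺ (eqFin-refl l) (cong not (eqFin-≢ b≢l))) (exit⇒≢ l)
    ... | cₑ , yₑ , entry≡ , yₑ∈ , entry | cₓ , yₓ , exit≡ , yₓ∈ , exit
      rewrite entry≡ | exit≡ =
      ∧-true⁺ (proj₁ (on-corner-sides cx∈))
              (∧-true⁺ (vertices-≢ yₑ∈ yₓ∈ (λ cₑ≡cₓ → cₑ₁≢l (trans (cong proj₁ cₑ≡cₓ) cₓ₁≡l)))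
                       (∧-true⁺ (vertices-≢ yₑ∈ cx∈ (λ cₑ≡c → cₑ₁≢l (cong proj₁ cₑ≡c)))
                                (vertices-≢ yₓ∈ cx∈ (λ cₓ≡c → cₓ₂≢l (cong proj₂ cₓ≡c)))))
      where
      cₑ₁≢l = eqFin-false⇒≢ (not-true⇒false (proj₁ (∧-true⁻ {not (eqFin (proj₁ cₑ) l)} entry)))
      cₓ₁≡l = eqFin⇒≡ (proj₁ (∧-true⁻ {eqFin (proj₁ cₓ) l} exit))
      cₓ₂≢l = eqFin-false⇒≢ (not-true⇒false (proj₂ (∧-true⁻ {eqFin (proj₁ cₓ) l} exit)))

    corner-satisfied : ∀ c x → (c , x) ∈ zip cs p → cornerConstraint cs c x ≡ true
    corner-satisfied (a , b) x cx∈ with eqFin a b in a≟b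
    ... | false = ∧-true⁺ (proj₁ (on-corner-sides cx∈)) (proj₂ (on-corner-sides cx∈))
    ... | true with eqFin⇒≡ {x = a} {b} a≟b
    ...   | refl = free-corner-satisfied cx∈

    constraints-satisfied : pointwise (constraints ℓ) p ≡ true
    constraints-satisfied = pointwise-zip (cornerConstraint cs) cs p length-corners corner-satisfied

  module _ (k j : ℕ) (2≤k : 2 ≤ k) (2≤j : 2 ≤ j) (2≤n : 2 ≤ n) where

    private
      #distinct : List Line → ℕ
      #distinct ℓ = countFin (λ l → any (eqFin l) ℓ)

      has-j-lines : Vec Point k → Bool
      has-j-lines G = isQuasiGon Π G ∧ (numLines Π G ≡ᵇ j)

      sides-equal : Vec Line k → Vec Point k → Bool
      sides-equal L G = pointwise (map eqFin (sides (toList G))) (toList L)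

    ∏countFin-constraints-≤ : ∀ ℓ → length ℓ ≡ k → #distinct ℓ ≡ j →
                              ∏countFin (constraints ℓ) ≤ (n ∸ 1) ^ (k ∸ j)
    ∏countFin-constraints-≤ ℓ |ℓ|≡k #ℓ≡j = ≤-trans (∏countFin-constraints (cornerPairs ℓ) (cornerPairs ℓ))
                                                   (^-monoʳ-≤ (n ∸ 1) {{>-nonZero (m<n⇒0<n∸m 2≤n)}} free≤k∸j)
      where
      changes = count (not ∘ isFree) (cornerPairs ℓ)
      free≤k∸j : count isFree (cornerPairs ℓ) ≤ k ∸ j
      free≤k∸j = begin
        count isFree (cornerPairs ℓ)                      ≡⟨ m+n∸n≡m _ changes ⟨
        count isFree (cornerPairs ℓ) + changes ∸ changes  ≡⟨ cong (_∸ changes) (count+count-not isFree (cornerPairs ℓ)) ⟩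
        length (cornerPairs ℓ) ∸ changes                  ≡⟨ cong (_∸ changes) (trans (length-cornerPairs ℓ) |ℓ|≡k) ⟩
        k ∸ changes                                       ≤⟨ ∸-monoʳ-≤ k j≤changes ⟩
        k ∸ j                                             ∎
        where
        open ≤-Reasoning
        j≤changes = subst (_≤ changes) #ℓ≡j (distinct≤changes ℓ (subst (2 ≤_) (sym #ℓ≡j) 2≤j))

    sides-equal⇒constraints : ∀ L G → has-j-lines G ∧ sides-equal L G ≡ true →
                              pointwise (constraints (toList L)) (toList G) ≡ true
    sides-equal⇒constraints L G hyp =
      let quasi , equal = ∧-true⁻ {has-j-lines G} hyp
          distinct , j-lines = ∧-true⁻ {isQuasiGon Π G} quasi
      in subst (λ ℓ → pointwise (constraints ℓ) (toList G) ≡ true) (pointwise-eqFin⇒≡ (sides (toList G)) (toList L) equal)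
               (satisfied 2≤k G distinct (trans (sym (numLines≡distinct-sides G)) (≡ᵇ⇒≡ _ j (≡true⇒T j-lines))))
      where
      satisfied : 2 ≤ k → ∀ G → allDistinct (toList G) ≡ true → #distinct (sides (toList G)) ≡ j →
                  pointwise (constraints (sides (toList G))) (toList G) ≡ true
      satisfied (s≤s (s≤s _)) (x₀ ∷ᵥ x₁ ∷ᵥ v) distinct #sides≡j =
        Polygon.constraints-satisfied x₀ x₁ (toList v) distinct (subst (2 ≤_) (sym #sides≡j) 2≤j)

    fibre-≤ : ∀ (L : Vec Line k) → count (λ G → has-j-lines G ∧ sides-equal L G) (allVecs (N n) k)
                                     ≤ 𝟙 (#distinct (toList L) ≡ᵇ j) * (n ∸ 1) ^ (k ∸ j)
    fibre-≤ L with #distinct (toList L) ≡ᵇ j in #L≟j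
    ... | false = ≤-reflexive (trans (∑-cong empty (allVecs (N n) k)) (∑-zero (allVecs (N n) k)))
      where
      empty : ∀ G → 𝟙 (has-j-lines G ∧ sides-equal L G) ≡ 0
      empty G with sides-equal L G in equal
      ... | false = cong 𝟙 (∧-zeroʳ (has-j-lines G))
      ... | true  = cong 𝟙 (trans (∧-identityʳ _) (trans (cong (isQuasiGon Π G ∧_) not-j) (∧-zeroʳ _)))
        where
        not-j : (numLines Π G ≡ᵇ j) ≡ false
        not-j = trans (cong (_≡ᵇ j) (trans (numLines≡distinct-sides G) (cong #distinct sides≡L))) #L≟j
          where sides≡L = pointwise-eqFin⇒≡ (sides (toList G)) (toList L) equal
    ... | true  = begin
      count (λ G → has-j-lines G ∧ sides-equal L G) (allVecs (N n) k)  ≤⟨ count-mono (sides-equal⇒constraints L) (allVecs (N n) k) ⟩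
      count (pointwise (constraints (toList L)) ∘ toList) (allVecs (N n) k)
        ≡⟨ count-allVecs-pointwise (N n) k (constraints (toList L)) |constraints|≡k ⟩
      ∏countFin (constraints (toList L))
        ≤⟨ ∏countFin-constraints-≤ (toList L) (Vec.length-toList L) (≡ᵇ⇒≡ _ j (≡true⇒T #L≟j)) ⟩
      (n ∸ 1) ^ (k ∸ j)                                                    ≡⟨ +-identityʳ _ ⟨
      1 * (n ∸ 1) ^ (k ∸ j)                                                ∎
      where
      open ≤-Reasoning
      |constraints|≡k = trans (List.length-map _ (cornerPairs (toList L))) (trans (length-cornerPairs (toList L)) (Vec.length-toList L))

    Qcount-≤ : Qcount Π k j ≤ j ^ (k ∸ j) * (k P j) * (N n C j) * (n ∸ 1) ^ (k ∸ j)
    Qcount-≤ = begin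
      Qcount Π k j
        ≡⟨ length-filter≡count has-j-lines V ⟩
      count has-j-lines V
        ≡⟨ ∑-cong unique-side-sequence V ⟩
      ∑[ G ∈ V ] count (λ L → has-j-lines G ∧ sides-equal L G) V
        ≡⟨ ∑-comm (λ G L → 𝟙 (has-j-lines G ∧ sides-equal L G)) V V ⟩
      ∑[ L ∈ V ] count (λ G → has-j-lines G ∧ sides-equal L G) V
        ≤⟨ ∑-mono-≤ fibre-≤ V ⟩
      ∑[ L ∈ V ] (𝟙 (#distinct (toList L) ≡ᵇ j) * X)
        ≡⟨ ∑-*ʳ (λ L → 𝟙 (#distinct (toList L) ≡ᵇ j)) X V ⟩
      count (λ L → #distinct (toList L) ≡ᵇ j) V * X
        ≤⟨ *-monoˡ-≤ X (count-distinct-values-≤ (N n) k j) ⟩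
      (N n C j) * (k P j) * j ^ (k ∸ j) * X
        ≡⟨ solve 4 (λ c p e x → c :* p :* e :* x := e :* p :* c :* x) refl (N n C j) (k P j) (j ^ (k ∸ j)) X ⟩
      j ^ (k ∸ j) * (k P j) * (N n C j) * X ∎
      where
      open ≤-Reasoning
      open +-*-Solver
      V = allVecs (N n) k
      X = (n ∸ 1) ^ (k ∸ j)
      unique-side-sequence : ∀ G → 𝟙 (has-j-lines G) ≡ count (λ L → has-j-lines G ∧ sides-equal L G) V
      unique-side-sequence G = sym (begin-equality
        count (λ L → has-j-lines G ∧ sides-equal L G) V
          ≡⟨ ∑-cong (λ L → 𝟙-∧ (has-j-lines G) (sides-equal L G)) V ⟩
        ∑[ L ∈ V ] (𝟙 (has-j-lines G) * 𝟙 (sides-equal L G))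
          ≡⟨ ∑-*ˡ (λ L → 𝟙 (sides-equal L G)) (𝟙 (has-j-lines G)) V ⟩
        𝟙 (has-j-lines G) * count (pointwise (map eqFin (sides (toList G))) ∘ toList) V
          ≡⟨ cong (𝟙 (has-j-lines G) *_) (count-allVecs-pointwise (N n) k (map eqFin (sides (toList G))) |sides|≡k) ⟩
        𝟙 (has-j-lines G) * ∏countFin (map eqFin (sides (toList G)))
          ≡⟨ cong (𝟙 (has-j-lines G) *_) (∏countFin-eqFin (sides (toList G))) ⟩
        𝟙 (has-j-lines G) * 1
          ≡⟨ *-identityʳ _ ⟩
        𝟙 (has-j-lines G) ∎)
        where
        |sides|≡k = trans (List.length-map eqFin (sides (toList G))) (trans (length-sides (toList G)) (Vec.length-toList G))

lemma6 : (k j n : ℕ) → 4 ≤ k → 2 ≤ j → j ≤ k ∸ 2 → k ≤ n → (Π : ProjectivePlane n) →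
             (Qcount Π k j ≤ j ^ (k ∸ j) * (k P j) * (N n C j) * (n ∸ 1) ^ (k ∸ j))
             × (Qcount Π k 1 ≡ N n * ((n + 1) P k))
lemma6 k@(suc (suc k′)) j n (s≤s (s≤s _)) 2≤j _ k≤n Π =
  Plane.Qcount-≤ Π k j 2≤k 2≤j (≤-trans 2≤k k≤n) , Plane.Qcount-one-line Π k′
  where
  2≤k : 2 ≤ k
  2≤k = s≤s (s≤s z≤n)
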